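{- For every $n\ge1$, the following identities of formal power series in $t$ hold: \[ \frac{B_n^{+}(t)}{(1-t)^{n+1}}=\sum_{k\ge0}\frac{(2k+1)^n+1}{2}\,t^k,\qquad \frac{B_n^{ - }(t)}{(1-t)^{n+1}}=\sum_{k\ge0}\frac{(2k+1)^n-1}{2}\,t^k. \]
   Context: The hyperoctahedral group $B_n$ consists of bijections $w$ of $\{ -n,\dots,n\}$ with $w(-i)=-w(i)$ for all $i$ (so $w(0)=0$), written $w=w(1)\cdots w(n)$. For $u\in S_n$ and $J\subseteq[n]$, $u^J\in B_n$ is given by $u^J(j)=u(j)$ for $j\notin J$ and $u^J(j)=-u(j)$ for $j\in J$; every $w\in B_n$ is uniquely of this form. The type B descent number is $\mathrm{des}_B(w)=|\{0\le i\le n-1: w(i)>w(i+1)\}|$ (with $w(0)=0$). The sign is $\mathrm{sgn}_B(u^J)=(-1)^{|J|}\mathrm{sgn}(u)$. Let $B_n^{\pm}=\{w\in B_n:\mathrm{sgn}_B(w)=\pm1\}$ and $B_n^{\pm}(t)=\sum_{w\in B_n^{\pm}}t^{\mathrm{des}_B(w)}$. -}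

module Defs where

open import Data.Bool using (Bool; true; false; if_then_else_; _∧_; not)
open import Data.Nat using (ℕ; zero; suc; _+_; _*_; _∸_; _^_; _<ᵇ_; _≡ᵇ_)
open import Data.Integer as ℤ using (ℤ; +_; -_)
open import Data.List as List using (List; []; _∷_; map; concatMap; length; filterᵇ; cartesianProduct; applyUpTo)
open import Data.Bool.ListAction using (any)
open import Data.Nat.ListAction using (sum)
open import Data.Vec as Vec using (Vec; []; _∷_; toList; zipWith)
open import Relation.Nullary.Decidable using (⌊_⌋)
open import Data.Product using (_×_; _,_; proj₁; proj₂)

vecsOver : {A : Set} → List A → (n : ℕ) → List (Vec A n)
vecsOver xs zero    = [] ∷ []
vecsOver xs (suc n) = concatMap (λ x → map (x ∷_) (vecsOver xs n)) xs

oneTo : ℕ → List ℕ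
oneTo n = applyUpTo suc n

distinct : List ℕ → Bool
distinct []       = true
distinct (x ∷ xs) = not (any (x ≡ᵇ_) xs) ∧ distinct xs

-- S_n : permutations u of [n], written u = u(1) ... u(n)
-- (words of length n over [n] with pairwise distinct letters)
Sym : (n : ℕ) → List (Vec ℕ n)
Sym n = filterᵇ (λ u → distinct (toList u)) (vecsOver (oneTo n) n)

-- A subset J ⊆ [n] as its characteristic vector (position j is true iff j ∈ J)
Subsets : (n : ℕ) → List (Vec Bool n)
Subsets n = vecsOver (true ∷ false ∷ []) n

-- B_n, parametrised by pairs (u , J) with u ∈ S_n, J ⊆ [n]; the element is u^J
-- (every w ∈ B_n is uniquely of this form)
SignedPerm : ℕ → Set
SignedPerm n = Vec ℕ n × Vec Bool n

Hyp : (n : ℕ) → List (SignedPerm n)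
Hyp n = cartesianProduct (Sym n) (Subsets n)

window : {n : ℕ} → SignedPerm n → Vec ℤ n
window (u , J) = zipWith (λ x b → if b then - (+ x) else + x) u J

descentsList : List ℤ → ℕ
descentsList []            = 0
descentsList (x ∷ [])      = 0
descentsList (x ∷ y ∷ xs)  = (if ⌊ y ℤ.<? x ⌋ then 1 else 0) + descentsList (y ∷ xs)

desB : {n : ℕ} → SignedPerm n → ℕ
desB w = descentsList (+ 0 ∷ toList (window w))

inversions : List ℕ → ℕ
inversions []       = 0
inversions (x ∷ xs) = length (filterᵇ (_<ᵇ x) xs) + inversions xs

negOnePow : ℕ → ℤ
negOnePow zero    = + 1
negOnePow (suc m) = - negOnePow m

sgn : {n : ℕ} → Vec ℕ n → ℤ
sgn u = negOnePow (inversions (toList u))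

card : {n : ℕ} → Vec Bool n → ℕ
card J = length (filterᵇ (λ b → b) (toList J))

sgnB : {n : ℕ} → SignedPerm n → ℤ
sgnB (u , J) = negOnePow (card J) ℤ.* sgn u

-- Formal power series in t with ℕ coefficients: coefficient sequences

FPS : Set
FPS = ℕ → ℕ

_⋆_ : FPS → FPS → FPS
(f ⋆ g) k = sum (map (λ i → f i * g (k ∸ i)) (List.upTo (suc k)))

oneS : FPS
oneS zero    = 1
oneS (suc _) = 0

_^ₛ_ : FPS → ℕ → FPS
f ^ₛ zero  = oneS
f ^ₛ suc m = f ⋆ (f ^ₛ m)

inv1-t : FPS
inv1-t _ = 1

BPlus : ℕ → FPS
BPlus n j = length (filterᵇ (λ w → (⌊ sgnB w ℤ.≟ + 1 ⌋) ∧ (desB w ≡ᵇ j)) (Hyp n))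

BMinus : ℕ → FPS
BMinus n j = length (filterᵇ (λ w → (⌊ sgnB w ℤ.≟ - (+ 1) ⌋) ∧ (desB w ≡ᵇ j)) (Hyp n))

-- The coefficient of t^k in B_n^±(t)/(1-t)^(n+1) counts the pairs (w , a) of a signed permutation w of
-- the given sign and a sequence k ≥ a₁ ≥ ⋯ ≥ aₙ ≥ 0 that drops strictly at every descent of 0 w(1) ⋯ w(n).
-- Over all w these are counted by letting each z ∈ [n] choose one of 2k+1 admissible pairs (a , ±z)
-- independently: sorting the n chosen pairs recovers w and a. So the total is (2k+1)^n.
-- The signed total is 1: splitting off the first letter, induction shows that the signed count of the
-- arrangements of a set A is ∏_{y ∈ A} [-y < p ≤ y], where p is the letter in front, which is 1 for p = 0.
-- So the positive and negative counts P and M satisfy P + M = (2k+1)^n and P - M = 1.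

module Submission where

open import Algebra.Core using (Op₂)
open import Algebra.Structures using (IsCommutativeSemiring)
open import Data.Bool using (Bool; true; false; if_then_else_; _∧_; _∨_; not; T)
open import Data.Bool.ListAction using (any; all)
open import Data.Bool.Properties using (not-injective; ∧-identityʳ)
open import Data.Empty using (⊥-elim)
open import Data.Integer as ℤ using (ℤ)
import Data.Integer.Properties as ℤP
open import Data.List as List
  using (List; []; _∷_; _++_; map; concat; concatMap; filterᵇ; cartesianProduct; applyUpTo; upTo; length)
open import Data.List.Properties using (map-upTo; upTo-∷ʳ; length-upTo; length-applyUpTo)
open import Data.Nat as ℕ
  using (ℕ; zero; suc; _+_; _*_; _∸_; _^_; _/_; _≡ᵇ_; _<ᵇ_; _≤ᵇ_; _≤_; _<_; z≤n; s≤s; z<s; s<s; _⊓_)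
open import Data.Nat.DivMod using (m*n/n≡m)
open import Data.Nat.ListAction using (sum)
open import Data.Nat.Properties
open import Data.Nat.Solver using (module +-*-Solver)
open import Data.Integer.Solver renaming (module +-*-Solver to ℤSolver)
open import Data.Product using (_×_; _,_; proj₁; proj₂; map₁; map₂)
open import Data.Sum using (_⊎_; inj₁; inj₂)
open import Data.Unit using (tt)
open import Data.Vec as Vec using (Vec; []; _∷_; toList)
open import Data.Vec.Properties using (length-toList)
open import Function using (_∘_)
open import Relation.Nullary using (¬_)
open import Relation.Nullary.Decidable using (Dec; does; no; ⌊_⌋; isYes≗does; dec-true; dec-false; does-⇔; decidable-stable; _×-dec_)
open import Function.Bundles using (mk⇔)
open import Relation.Binary using (tri<; tri≈; tri>)
open import Relation.Binary.PropositionalEquality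
open ≡-Reasoning

open import Defs

≡true⇒T : ∀ {b} → b ≡ true → T b
≡true⇒T refl = tt

∧-true : ∀ {a b} → a ∧ b ≡ true → a ≡ true × b ≡ true
∧-true {true} {true} _ = refl , refl

true≢false : true ≢ false
true≢false ()

≡ᵇ⇒≡′ : ∀ x y → (x ≡ᵇ y) ≡ true → x ≡ y
≡ᵇ⇒≡′ x y e = ≡ᵇ⇒≡ x y (≡true⇒T e)

<ᵇ⇒<′ : ∀ x y → (x <ᵇ y) ≡ true → x < y
<ᵇ⇒<′ x y e = <ᵇ⇒< x y (≡true⇒T e)

≤ᵇ⇒≤′ : ∀ x y → (x ≤ᵇ y) ≡ true → x ≤ y
≤ᵇ⇒≤′ x y e = ≤ᵇ⇒≤ x y (≡true⇒T e)

does-false⇒¬ : ∀ {P : Set} (d : Dec P) → does d ≡ false → ¬ P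
does-false⇒¬ (no ¬p) _ = ¬p

≡ᵇ-refl : ∀ x → (x ≡ᵇ x) ≡ true
≡ᵇ-refl x = dec-true (x ≟ x) refl

_∈ᵇ_ : ℕ → List ℕ → Bool
x ∈ᵇ xs = any (x ≡ᵇ_) xs

delete : ℕ → List ℕ → List ℕ
delete x = filterᵇ (λ y → not (x ≡ᵇ y))

_⊆ᵇ_ : List ℕ → List ℕ → Bool
xs ⊆ᵇ ys = all (_∈ᵇ ys) xs

∈ᵇ-head : ∀ x xs → (x ∈ᵇ (x ∷ xs)) ≡ true
∈ᵇ-head x xs rewrite ≡ᵇ-refl x = refl

∈ᵇ-there : ∀ x y xs → (x ∈ᵇ xs) ≡ true → (x ∈ᵇ (y ∷ xs)) ≡ true
∈ᵇ-there x y xs e with x ≡ᵇ y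
... | true  = refl
... | false = e

∈ᵇ-∷-false : ∀ x y xs → (x ∈ᵇ (y ∷ xs)) ≡ false → (x ≡ᵇ y) ≡ false × (x ∈ᵇ xs) ≡ false
∈ᵇ-∷-false x y xs e with x ≡ᵇ y
... | false = refl , e

∈ᵇ-∉-≢ : ∀ x y xs → (x ∈ᵇ xs) ≡ true → (y ∈ᵇ xs) ≡ false → (x ≡ᵇ y) ≡ false
∈ᵇ-∉-≢ x y xs x∈ y∉ with x ≡ᵇ y in eq
... | true  = ⊥-elim (true≢false (trans (sym x∈) (subst (λ t → (t ∈ᵇ xs) ≡ false) (sym (≡ᵇ⇒≡′ x y eq)) y∉)))
... | false = refl

delete-∷-≢ : ∀ x a A → (x ≡ᵇ a) ≡ false → delete x (a ∷ A) ≡ a ∷ delete x A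
delete-∷-≢ x a A e rewrite e = refl

delete-∉ : ∀ x A → (x ∈ᵇ A) ≡ false → delete x A ≡ A
delete-∉ x []      e = refl
delete-∉ x (a ∷ A) e with ∈ᵇ-∷-false x a A e
... | x≢a , x∉A = trans (delete-∷-≢ x a A x≢a) (cong (a ∷_) (delete-∉ x A x∉A))

delete-head : ∀ x A → (x ∈ᵇ A) ≡ false → delete x (x ∷ A) ≡ A
delete-head x A x∉A rewrite ≡ᵇ-refl x = delete-∉ x A x∉A

∈ᵇ-filterᵇ⁻ : ∀ (q : ℕ → Bool) y ys → (y ∈ᵇ filterᵇ q ys) ≡ true → (y ∈ᵇ ys) ≡ true × q y ≡ true
∈ᵇ-filterᵇ⁻ q y []       ()
∈ᵇ-filterᵇ⁻ q y (a ∷ ys) e with q a in qa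
... | false = map₁ (∈ᵇ-there y a ys) (∈ᵇ-filterᵇ⁻ q y ys e)
... | true with y ≡ᵇ a in ya
...   | true  = refl , subst (λ t → q t ≡ true) (sym (≡ᵇ⇒≡′ y a ya)) qa
...   | false = ∈ᵇ-filterᵇ⁻ q y ys e

∈ᵇ-filterᵇ⁺ : ∀ (q : ℕ → Bool) y ys → (y ∈ᵇ ys) ≡ true → q y ≡ true → (y ∈ᵇ filterᵇ q ys) ≡ true
∈ᵇ-filterᵇ⁺ q y []       () qy
∈ᵇ-filterᵇ⁺ q y (a ∷ ys) m qy with y ≡ᵇ a in ya | q a in qa
... | true  | true  rewrite ya = refl
... | true  | false = ⊥-elim (true≢false (trans (sym qy) (subst (λ t → q t ≡ false) (sym (≡ᵇ⇒≡′ y a ya)) qa)))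
... | false | true  rewrite ya = ∈ᵇ-filterᵇ⁺ q y ys m qy
... | false | false = ∈ᵇ-filterᵇ⁺ q y ys m qy

∈ᵇ-delete⁻ : ∀ x y A → (y ∈ᵇ delete x A) ≡ true → (y ∈ᵇ A) ≡ true × (x ≡ᵇ y) ≡ false
∈ᵇ-delete⁻ x y A e = map₂ not-injective (∈ᵇ-filterᵇ⁻ (λ z → not (x ≡ᵇ z)) y A e)

∈ᵇ-delete⁺ : ∀ x y A → (y ∈ᵇ A) ≡ true → (x ≡ᵇ y) ≡ false → (y ∈ᵇ delete x A) ≡ true
∈ᵇ-delete⁺ x y A m x≢y = ∈ᵇ-filterᵇ⁺ (λ z → not (x ≡ᵇ z)) y A m (cong not x≢y)

distinct-filterᵇ : ∀ (q : ℕ → Bool) xs → distinct xs ≡ true → distinct (filterᵇ q xs) ≡ true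
distinct-filterᵇ q []       d = refl
distinct-filterᵇ q (x ∷ xs) d with q x | ∧-true {not (x ∈ᵇ xs)} d
... | false | _ , dxs = distinct-filterᵇ q xs dxs
... | true  | x∉xs , dxs with x ∈ᵇ filterᵇ q xs in e
...   | true  = ⊥-elim (true≢false (trans (sym (proj₁ (∈ᵇ-filterᵇ⁻ q x xs e))) (not-injective x∉xs)))
...   | false = distinct-filterᵇ q xs dxs

distinct-delete : ∀ x A → distinct A ≡ true → distinct (delete x A) ≡ true
distinct-delete x = distinct-filterᵇ (λ y → not (x ≡ᵇ y))

length-delete : ∀ x A → distinct A ≡ true → (x ∈ᵇ A) ≡ true → suc (length (delete x A)) ≡ length A
length-delete x []      d ()
length-delete x (a ∷ A) d m with x ≡ᵇ a in xa | ∧-true {not (a ∈ᵇ A)} d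
... | true  | a∉A , _ = cong (suc ∘ length)
      (delete-∉ x A (subst (λ t → (t ∈ᵇ A) ≡ false) (sym (≡ᵇ⇒≡′ x a xa)) (not-injective a∉A)))
... | false | _ , dA = cong suc (length-delete x A dA m)

all-∈ᵇ : ∀ (q : ℕ → Bool) x A → all q A ≡ true → (x ∈ᵇ A) ≡ true → q x ≡ true
all-∈ᵇ q x []      _  ()
all-∈ᵇ q x (a ∷ A) qA m with ∧-true {q a} qA | x ≡ᵇ a in xa
... | qa , _  | true  = subst (λ t → q t ≡ true) (sym (≡ᵇ⇒≡′ x a xa)) qa
... | _  , qA | false = all-∈ᵇ q x A qA m

all-filterᵇ : ∀ (q p : ℕ → Bool) A → all q A ≡ true → all q (filterᵇ p A) ≡ true
all-filterᵇ q p []      _ = refl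
all-filterᵇ q p (a ∷ A) qA with ∧-true {q a} qA | p a
... | _  , qA′ | false = all-filterᵇ q p A qA′
... | qa , qA′ | true rewrite qa = all-filterᵇ q p A qA′

all-delete : ∀ (q : ℕ → Bool) x A → all q A ≡ true → all q (delete x A) ≡ true
all-delete q x = all-filterᵇ q (λ y → not (x ≡ᵇ y))

⊆ᵇ-filterᵇ : ∀ (q : ℕ → Bool) xs ys → (xs ⊆ᵇ ys) ≡ true → (filterᵇ q xs ⊆ᵇ filterᵇ q ys) ≡ true
⊆ᵇ-filterᵇ q []       ys _ = refl
⊆ᵇ-filterᵇ q (x ∷ xs) ys s with q x in qx | ∧-true {x ∈ᵇ ys} s
... | false | _ , s′ = ⊆ᵇ-filterᵇ q xs ys s′
... | true  | m , s′ rewrite ∈ᵇ-filterᵇ⁺ q x ys m qx = ⊆ᵇ-filterᵇ q xs ys s′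

⊆ᵇ-delete : ∀ x xs ys → (x ∈ᵇ xs) ≡ false → (xs ⊆ᵇ ys) ≡ true → (xs ⊆ᵇ delete x ys) ≡ true
⊆ᵇ-delete x []       ys _ _ = refl
⊆ᵇ-delete x (z ∷ zs) ys x∉ s with ∧-true {z ∈ᵇ ys} s | ∈ᵇ-∷-false x z zs x∉
... | z∈ , s′ | x≢z , x∉zs rewrite ∈ᵇ-delete⁺ x z ys z∈ x≢z = ⊆ᵇ-delete x zs ys x∉zs s′

distinct-⊆ᵇ⇒length≤ : ∀ xs ys → distinct xs ≡ true → distinct ys ≡ true → (xs ⊆ᵇ ys) ≡ true → length xs ≤ length ys
distinct-⊆ᵇ⇒length≤ []       ys _ _ _ = z≤n
distinct-⊆ᵇ⇒length≤ (x ∷ xs) ys dxs dys s with ∧-true {not (x ∈ᵇ xs)} dxs | ∧-true {x ∈ᵇ ys} s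
... | x∉xs , dxs′ | x∈ys , s′ = ≤-trans
  (s≤s (distinct-⊆ᵇ⇒length≤ xs (delete x ys) dxs′ (distinct-delete x ys dys) (⊆ᵇ-delete x xs ys (not-injective x∉xs) s′)))
  (≤-reflexive (length-delete x ys dys x∈ys))

length-filterᵇ+not : ∀ (q : ℕ → Bool) xs → length (filterᵇ q xs) + length (filterᵇ (not ∘ q) xs) ≡ length xs
length-filterᵇ+not q []       = refl
length-filterᵇ+not q (a ∷ xs) with q a
... | true  = cong suc (length-filterᵇ+not q xs)
... | false = trans (+-suc _ _) (cong suc (length-filterᵇ+not q xs))

length-filterᵇ-⊆ᵇ : ∀ (q : ℕ → Bool) xs ys → distinct xs ≡ true → distinct ys ≡ true → (xs ⊆ᵇ ys) ≡ true →
  length xs ≡ length ys → length (filterᵇ q xs) ≡ length (filterᵇ q ys)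
length-filterᵇ-⊆ᵇ q xs ys dxs dys s len = ≤-antisym (bound q) (+-cancelʳ-≤ _ _ _ complement)
  where
  bound : ∀ p → length (filterᵇ p xs) ≤ length (filterᵇ p ys)
  bound p = distinct-⊆ᵇ⇒length≤ (filterᵇ p xs) (filterᵇ p ys)
    (distinct-filterᵇ p xs dxs) (distinct-filterᵇ p ys dys) (⊆ᵇ-filterᵇ p xs ys s)
  complement : length (filterᵇ q ys) + length (filterᵇ (not ∘ q) ys) ≤ length (filterᵇ q xs) + length (filterᵇ (not ∘ q) ys)
  complement = subst (_≤ length (filterᵇ q xs) + length (filterᵇ (not ∘ q) ys))
    (sym (trans (length-filterᵇ+not q ys) (trans (sym len) (sym (length-filterᵇ+not q xs)))))
    (+-monoʳ-≤ (length (filterᵇ q xs)) (bound (not ∘ q)))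

all-applyUpTo : (q : ℕ → Bool) (g : ℕ → ℕ) (n : ℕ) → (∀ i → i < n → q (g i) ≡ true) → all q (applyUpTo g n) ≡ true
all-applyUpTo q g zero    h = refl
all-applyUpTo q g (suc n) h rewrite h 0 z<s = all-applyUpTo q (g ∘ suc) n (λ i i<n → h (suc i) (s<s i<n))

∉ᵇ-all-> : ∀ t A → all (t <ᵇ_) A ≡ true → (t ∈ᵇ A) ≡ false
∉ᵇ-all-> t []      _ = refl
∉ᵇ-all-> t (a ∷ A) h with ∧-true {t <ᵇ a} h
... | t<a , rest rewrite dec-false (t ≟ a) (<⇒≢ (<ᵇ⇒<′ t a t<a)) = ∉ᵇ-all-> t A rest

increasing-head : (g : ℕ → ℕ) → (∀ i → g i < g (suc i)) → ∀ i → g 0 < g (suc i)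
increasing-head g h zero    = h 0
increasing-head g h (suc i) = <-trans (increasing-head g h i) (h (suc i))

distinct-applyUpTo : (g : ℕ → ℕ) (n : ℕ) → (∀ i → g i < g (suc i)) → distinct (applyUpTo g n) ≡ true
distinct-applyUpTo g zero    h = refl
distinct-applyUpTo g (suc n) h
  rewrite ∉ᵇ-all-> (g 0) (applyUpTo (g ∘ suc) n)
            (all-applyUpTo (g 0 <ᵇ_) (g ∘ suc) n (λ i _ → dec-true (g 0 <? g (suc i)) (increasing-head g h i)))
  = distinct-applyUpTo (g ∘ suc) n (λ i → h (suc i))

module FiniteSums {R : Set} {_+_ _*_ : Op₂ R} {0# 1# : R}
                  (isCS : IsCommutativeSemiring _≡_ _+_ _*_ 0# 1#) where

  private module S = IsCommutativeSemiring isCS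

  ∑ : {A : Set} → List A → (A → R) → R
  ∑ []       f = 0#
  ∑ (x ∷ xs) f = f x + ∑ xs f

  ∏ : {A : Set} → List A → (A → R) → R
  ∏ []       f = 1#
  ∏ (x ∷ xs) f = f x * ∏ xs f

  when : Bool → R → R
  when b r = if b then r else 0#

  ∑-cong : {A : Set} (xs : List A) {f g : A → R} → (∀ x → f x ≡ g x) → ∑ xs f ≡ ∑ xs g
  ∑-cong []       e = refl
  ∑-cong (x ∷ xs) e = cong₂ _+_ (e x) (∑-cong xs e)

  ∑-cong-∈ᵇ : (A : List ℕ) {f g : ℕ → R} → (∀ x → (x ∈ᵇ A) ≡ true → f x ≡ g x) → ∑ A f ≡ ∑ A g
  ∑-cong-∈ᵇ []      e = refl
  ∑-cong-∈ᵇ (a ∷ A) e = cong₂ _+_ (e a (∈ᵇ-head a A)) (∑-cong-∈ᵇ A (λ x m → e x (∈ᵇ-there x a A m)))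

  ∏-cong-∈ᵇ : (A : List ℕ) {f g : ℕ → R} → (∀ x → (x ∈ᵇ A) ≡ true → f x ≡ g x) → ∏ A f ≡ ∏ A g
  ∏-cong-∈ᵇ []      e = refl
  ∏-cong-∈ᵇ (a ∷ A) e = cong₂ _*_ (e a (∈ᵇ-head a A)) (∏-cong-∈ᵇ A (λ x m → e x (∈ᵇ-there x a A m)))

  ∑-zero : {A : Set} (xs : List A) {f : A → R} → (∀ x → f x ≡ 0#) → ∑ xs f ≡ 0#
  ∑-zero []       e = refl
  ∑-zero (x ∷ xs) e = trans (cong₂ _+_ (e x) (∑-zero xs e)) (S.+-identityˡ 0#)

  ∑-++ : {A : Set} (xs ys : List A) (f : A → R) → ∑ (xs ++ ys) f ≡ ∑ xs f + ∑ ys f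
  ∑-++ []       ys f = sym (S.+-identityˡ _)
  ∑-++ (x ∷ xs) ys f = trans (cong (f x +_) (∑-++ xs ys f)) (sym (S.+-assoc _ _ _))

  ∑-map : {A B : Set} (g : A → B) (xs : List A) (f : B → R) → ∑ (map g xs) f ≡ ∑ xs (f ∘ g)
  ∑-map g []       f = refl
  ∑-map g (x ∷ xs) f = cong (f (g x) +_) (∑-map g xs f)

  ∑-concatMap : {A B : Set} (g : A → List B) (xs : List A) (f : B → R) →
    ∑ (concatMap g xs) f ≡ ∑ xs (λ x → ∑ (g x) f)
  ∑-concatMap g []       f = refl
  ∑-concatMap g (x ∷ xs) f = trans (∑-++ (g x) (concat (map g xs)) f) (cong (∑ (g x) f +_) (∑-concatMap g xs f))

  ∑-+ : {A : Set} (xs : List A) (f g : A → R) → ∑ xs (λ x → f x + g x) ≡ ∑ xs f + ∑ xs g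
  ∑-+ []       f g = sym (S.+-identityˡ 0#)
  ∑-+ (x ∷ xs) f g = begin
    (f x + g x) + ∑ xs (λ x → f x + g x) ≡⟨ cong ((f x + g x) +_) (∑-+ xs f g) ⟩
    (f x + g x) + (∑ xs f + ∑ xs g)      ≡⟨ S.+-assoc (f x) (g x) _ ⟩
    f x + (g x + (∑ xs f + ∑ xs g))      ≡⟨ cong (f x +_) (trans (sym (S.+-assoc (g x) _ _))
                                               (trans (cong (_+ ∑ xs g) (S.+-comm (g x) _)) (S.+-assoc _ (g x) _))) ⟩
    f x + (∑ xs f + (g x + ∑ xs g))      ≡⟨ sym (S.+-assoc (f x) _ _) ⟩
    (f x + ∑ xs f) + (g x + ∑ xs g)      ∎

  *-∑ : {A : Set} (a : R) (xs : List A) (f : A → R) → a * ∑ xs f ≡ ∑ xs (λ x → a * f x)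
  *-∑ a []       f = S.zeroʳ a
  *-∑ a (x ∷ xs) f = trans (S.distribˡ a _ _) (cong ((a * f x) +_) (*-∑ a xs f))

  ∑-* : {A : Set} (xs : List A) (f : A → R) (a : R) → ∑ xs f * a ≡ ∑ xs (λ x → f x * a)
  ∑-* xs f a = trans (S.*-comm _ a) (trans (*-∑ a xs f) (∑-cong xs (λ x → S.*-comm a (f x))))

  ∑-comm : {A B : Set} (xs : List A) (ys : List B) (f : A → B → R) →
    ∑ xs (λ x → ∑ ys (f x)) ≡ ∑ ys (λ y → ∑ xs (λ x → f x y))
  ∑-comm []       ys f = sym (∑-zero ys (λ _ → refl))
  ∑-comm (x ∷ xs) ys f =
    trans (cong (∑ ys (f x) +_) (∑-comm xs ys f)) (sym (∑-+ ys (f x) (λ y → ∑ xs (λ x → f x y))))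

  ∑-filterᵇ : {A : Set} (p : A → Bool) (xs : List A) (f : A → R) → ∑ (filterᵇ p xs) f ≡ ∑ xs (λ x → when (p x) (f x))
  ∑-filterᵇ p []       f = refl
  ∑-filterᵇ p (x ∷ xs) f with p x
  ... | true  = cong (f x +_) (∑-filterᵇ p xs f)
  ... | false = trans (∑-filterᵇ p xs f) (sym (S.+-identityˡ _))

  ∑-cartesianProduct : {A B : Set} (xs : List A) (ys : List B) (f : A × B → R) →
    ∑ (cartesianProduct xs ys) f ≡ ∑ xs (λ x → ∑ ys (λ y → f (x , y)))
  ∑-cartesianProduct []       ys f = refl
  ∑-cartesianProduct (x ∷ xs) ys f = trans (∑-++ (map (x ,_) ys) _ f)
    (cong₂ _+_ (∑-map (x ,_) ys f) (∑-cartesianProduct xs ys f))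

  when-∑ : {A : Set} (b : Bool) (xs : List A) (f : A → R) → when b (∑ xs f) ≡ ∑ xs (λ x → when b (f x))
  when-∑ true  xs f = refl
  when-∑ false xs f = sym (∑-zero xs (λ _ → refl))

  when-∧ : ∀ a b r → when (a ∧ b) r ≡ when a (when b r)
  when-∧ true  b r = refl
  when-∧ false b r = refl

  when-* : ∀ b c r → when b (c * r) ≡ c * when b r
  when-* true  c r = refl
  when-* false c r = sym (S.zeroʳ c)

  ∑< : ℕ → (ℕ → R) → R
  ∑< n f = ∑ (upTo n) f

  ∑<-suc : ∀ n f → ∑< (suc n) f ≡ f 0 + ∑< n (f ∘ suc)
  ∑<-suc n f = cong (f 0 +_) (trans (cong (λ l → ∑ l f) (sym (map-upTo suc n))) (∑-map suc (upTo n) f))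

  ∑<-∷ʳ : ∀ n f → ∑< (suc n) f ≡ ∑< n f + f n
  ∑<-∷ʳ n f = begin
    ∑ (upTo (suc n)) f          ≡⟨ cong (λ l → ∑ l f) (sym (upTo-∷ʳ n)) ⟩
    ∑ (upTo n List.∷ʳ n) f      ≡⟨ ∑-++ (upTo n) (n ∷ []) f ⟩
    ∑< n f + (f n + 0#)         ≡⟨ cong (∑< n f +_) (trans (S.+-comm (f n) 0#) (S.+-identityˡ (f n))) ⟩
    ∑< n f + f n                ∎

  ∑<-cong : ∀ n {f g : ℕ → R} → (∀ a → a < n → f a ≡ g a) → ∑< n f ≡ ∑< n g
  ∑<-cong zero    e = refl
  ∑<-cong (suc n) {f} {g} e = begin
    ∑< (suc n) f            ≡⟨ ∑<-suc n f ⟩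
    f 0 + ∑< n (f ∘ suc)    ≡⟨ cong₂ _+_ (e 0 z<s) (∑<-cong n (λ a a<n → e (suc a) (s<s a<n))) ⟩
    g 0 + ∑< n (g ∘ suc)    ≡⟨ sym (∑<-suc n g) ⟩
    ∑< (suc n) g            ∎

  ∑<-restrict : ∀ N r (f : ℕ → R) → r ≤ N → ∑< r f ≡ ∑< N (λ a → when (a <ᵇ r) (f a))
  ∑<-restrict zero    zero    f _ = refl
  ∑<-restrict (suc N) zero    f _ = sym (∑-zero (upTo (suc N)) (λ _ → refl))
  ∑<-restrict (suc N) (suc r) f (s≤s r≤N) = begin
    ∑< (suc r) f                                       ≡⟨ ∑<-suc r f ⟩
    f 0 + ∑< r (f ∘ suc)                               ≡⟨ cong (f 0 +_) (∑<-restrict N r (f ∘ suc) r≤N) ⟩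
    f 0 + ∑< N (λ a → when (a <ᵇ r) (f (suc a)))       ≡⟨ sym (∑<-suc N (λ a → when (a <ᵇ suc r) (f a))) ⟩
    ∑< (suc N) (λ a → when (a <ᵇ suc r) (f a))         ∎

  ∏-1 : {A : Set} (xs : List A) → ∏ xs (λ _ → 1#) ≡ 1#
  ∏-1 []       = refl
  ∏-1 (x ∷ xs) = trans (S.*-identityˡ _) (∏-1 xs)

  *-absorb : ∀ a b c t → (c * b) ≡ 0# → (a * (c * t)) ≡ c * ((a + b) * t)
  *-absorb a b c t cb≡0 = begin
    a * (c * t)                     ≡⟨ sym (S.+-identityʳ _) ⟩
    (a * (c * t)) + 0#              ≡⟨ cong ((a * (c * t)) +_) (sym (trans (cong (_* t) cb≡0) (S.zeroˡ t))) ⟩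
    (a * (c * t)) + ((c * b) * t)   ≡⟨ cong₂ _+_ (trans (sym (S.*-assoc a c t))
                                        (trans (cong (_* t) (S.*-comm a c)) (S.*-assoc c a t))) (S.*-assoc c b t) ⟩
    (c * (a * t)) + (c * (b * t))   ≡⟨ sym (S.distribˡ c _ _) ⟩
    c * ((a * t) + (b * t))         ≡⟨ cong (c *_) (sym (S.distribʳ t a b)) ⟩
    c * ((a + b) * t)               ∎

  -- Multiplying out, every term that picks the e-part of two distinct factors vanishes.
  ∏-+-disjoint : ∀ A (f e : ℕ → R) → distinct A ≡ true →
    (∀ x y → (x ∈ᵇ A) ≡ true → (y ∈ᵇ A) ≡ true → (x ≡ᵇ y) ≡ false → (e x * e y) ≡ 0#) →
    ∏ A (λ z → f z + e z) ≡ ∏ A f + ∑ A (λ x → e x * ∏ (delete x A) (λ z → f z + e z))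
  ∏-+-disjoint []      f e d h = sym (S.+-identityʳ 1#)
  ∏-+-disjoint (b ∷ A) f e d h = begin
    (f b + e b) * Q                           ≡⟨ S.distribʳ Q (f b) (e b) ⟩
    (f b * Q) + (e b * Q)                     ≡⟨ cong (λ t → (f b * t) + (e b * Q)) IH ⟩
    (f b * (P + Σ′)) + (e b * Q)              ≡⟨ cong (_+ (e b * Q)) (S.distribˡ (f b) P Σ′) ⟩
    ((f b * P) + (f b * Σ′)) + (e b * Q)      ≡⟨ S.+-assoc (f b * P) (f b * Σ′) (e b * Q) ⟩
    (f b * P) + ((f b * Σ′) + (e b * Q))      ≡⟨ cong ((f b * P) +_) (S.+-comm (f b * Σ′) (e b * Q)) ⟩
    (f b * P) + ((e b * Q) + (f b * Σ′))      ≡⟨ cong₂ (λ l t → (f b * P) + ((e b * ∏ l (λ z → f z + e z)) + t))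
                                                      (sym (delete-head b A b∉A)) absorb ⟩
    (f b * P) + ((e b * ∏ (delete b (b ∷ A)) (λ z → f z + e z))
                 + ∑ A (λ x → e x * ∏ (delete x (b ∷ A)) (λ z → f z + e z))) ∎
    where
    b∉A : (b ∈ᵇ A) ≡ false
    b∉A = not-injective (proj₁ (∧-true {not (b ∈ᵇ A)} d))
    Q = ∏ A (λ z → f z + e z)
    P = ∏ A f
    Σ′ = ∑ A (λ x → e x * ∏ (delete x A) (λ z → f z + e z))
    IH : Q ≡ P + Σ′
    IH = ∏-+-disjoint A f e (proj₂ (∧-true {not (b ∈ᵇ A)} d))
           (λ x y mx my → h x y (∈ᵇ-there x b A mx) (∈ᵇ-there y b A my))
    absorb : (f b * Σ′) ≡ ∑ A (λ x → e x * ∏ (delete x (b ∷ A)) (λ z → f z + e z))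
    absorb = trans (*-∑ (f b) A _) (∑-cong-∈ᵇ A (λ x x∈A →
      let x≢b = ∈ᵇ-∉-≢ x b A x∈A b∉A in
      trans (*-absorb (f b) (e b) (e x) _ (h x b (∈ᵇ-there x b A x∈A) (∈ᵇ-head b A) x≢b))
            (cong (λ l → e x * ∏ l (λ z → f z + e z)) (sym (delete-∷-≢ x b A x≢b)))))

  ∑-vecsOver-suc : {A : Set} (xs : List A) (m : ℕ) (G : Vec A (suc m) → R) →
    ∑ (vecsOver xs (suc m)) G ≡ ∑ xs (λ x → ∑ (vecsOver xs m) (λ v → G (x ∷ v)))
  ∑-vecsOver-suc xs m G = trans (∑-concatMap (λ x → map (x ∷_) (vecsOver xs m)) xs G)
    (∑-cong xs (λ x → ∑-map (x ∷_) (vecsOver xs m) G))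

  ∑-vecsOver-cong-⊆ᵇ : (A : List ℕ) (m : ℕ) {f g : Vec ℕ m → R} →
    (∀ v → (toList v ⊆ᵇ A) ≡ true → f v ≡ g v) → ∑ (vecsOver A m) f ≡ ∑ (vecsOver A m) g
  ∑-vecsOver-cong-⊆ᵇ A zero    e = cong (_+ 0#) (e [] refl)
  ∑-vecsOver-cong-⊆ᵇ A (suc m) {f} {g} e = begin
    ∑ (vecsOver A (suc m)) f                              ≡⟨ ∑-vecsOver-suc A m f ⟩
    ∑ A (λ x → ∑ (vecsOver A m) (λ v → f (x ∷ v)))        ≡⟨ ∑-cong-∈ᵇ A (λ x x∈A →
                                                               ∑-vecsOver-cong-⊆ᵇ A m (λ v v⊆A → e (x ∷ v) (cong₂ _∧_ x∈A v⊆A))) ⟩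
    ∑ A (λ x → ∑ (vecsOver A m) (λ v → g (x ∷ v)))        ≡⟨ sym (∑-vecsOver-suc A m g) ⟩
    ∑ (vecsOver A (suc m)) g                              ∎

  ∑-vecsOver-avoiding : (A : List ℕ) (x : ℕ) (m : ℕ) (G : Vec ℕ m → R) →
    ∑ (vecsOver A m) (λ v → when (not (x ∈ᵇ toList v)) (G v)) ≡ ∑ (vecsOver (delete x A) m) G
  ∑-vecsOver-avoiding A x zero    G = refl
  ∑-vecsOver-avoiding A x (suc m) G = begin
    ∑ (vecsOver A (suc m)) (λ v → when (not (x ∈ᵇ toList v)) (G v))
      ≡⟨ ∑-vecsOver-suc A m _ ⟩
    ∑ A (λ y → ∑ (vecsOver A m) (λ v → when (not ((x ≡ᵇ y) ∨ (x ∈ᵇ toList v))) (G (y ∷ v))))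
      ≡⟨ ∑-cong A (λ y → head-avoids y (x ≡ᵇ y)) ⟩
    ∑ A (λ y → when (not (x ≡ᵇ y)) (∑ (vecsOver (delete x A) m) (λ v → G (y ∷ v))))
      ≡⟨ sym (∑-filterᵇ (λ y → not (x ≡ᵇ y)) A _) ⟩
    ∑ (delete x A) (λ y → ∑ (vecsOver (delete x A) m) (λ v → G (y ∷ v)))
      ≡⟨ sym (∑-vecsOver-suc (delete x A) m G) ⟩
    ∑ (vecsOver (delete x A) (suc m)) G ∎
    where
    head-avoids : ∀ y b → ∑ (vecsOver A m) (λ v → when (not (b ∨ (x ∈ᵇ toList v))) (G (y ∷ v)))
                          ≡ when (not b) (∑ (vecsOver (delete x A) m) (λ v → G (y ∷ v)))
    head-avoids y true  = ∑-zero (vecsOver A m) (λ _ → refl)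
    head-avoids y false = ∑-vecsOver-avoiding A x m (λ v → G (y ∷ v))

  bools : List Bool
  bools = true ∷ false ∷ []

  -- For A = oneTo n and m = n the pairs (u , J) summed over are the signed permutations u^J.
  ∑Signed : (A : List ℕ) (m : ℕ) → (Vec ℕ m → Vec Bool m → R) → R
  ∑Signed A m F = ∑ (vecsOver A m) (λ u → when (distinct (toList u)) (∑ (Subsets m) (F u)))

  ∑-Hyp : (n : ℕ) (F : SignedPerm n → R) → ∑ (Hyp n) F ≡ ∑Signed (oneTo n) n (λ u J → F (u , J))
  ∑-Hyp n F = trans (∑-cartesianProduct (Sym n) (Subsets n) F)
                    (∑-filterᵇ (λ u → distinct (toList u)) (vecsOver (oneTo n) n) _)

  ∑Signed-∷ : (A : List ℕ) (m : ℕ) (F : Vec ℕ (suc m) → Vec Bool (suc m) → R) →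
    ∑Signed A (suc m) F ≡ ∑ A (λ x → ∑ bools (λ b → ∑Signed (delete x A) m (λ u J → F (x ∷ u) (b ∷ J))))
  ∑Signed-∷ A m F = begin
    ∑Signed A (suc m) F
      ≡⟨ ∑-vecsOver-suc A m _ ⟩
    ∑ A (λ x → ∑ (vecsOver A m) (λ v → when (not (x ∈ᵇ toList v) ∧ distinct (toList v)) (∑ (Subsets (suc m)) (F (x ∷ v)))))
      ≡⟨ ∑-cong A (λ x → ∑-cong (vecsOver A m) (λ v → split-head x v)) ⟩
    ∑ A (λ x → ∑ (vecsOver A m) (λ v → ∑ bools (λ b → when (not (x ∈ᵇ toList v)) (H x v b))))
      ≡⟨ ∑-cong A (λ x → ∑-comm (vecsOver A m) bools (λ v b → when (not (x ∈ᵇ toList v)) (H x v b))) ⟩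
    ∑ A (λ x → ∑ bools (λ b → ∑ (vecsOver A m) (λ v → when (not (x ∈ᵇ toList v)) (H x v b))))
      ≡⟨ ∑-cong A (λ x → ∑-cong bools (λ b → ∑-vecsOver-avoiding A x m (λ v → H x v b))) ⟩
    ∑ A (λ x → ∑ bools (λ b → ∑Signed (delete x A) m (λ u J → F (x ∷ u) (b ∷ J)))) ∎
    where
    H : ℕ → Vec ℕ m → Bool → R
    H x v b = when (distinct (toList v)) (∑ (Subsets m) (λ J → F (x ∷ v) (b ∷ J)))
    split-head : ∀ x v → when (not (x ∈ᵇ toList v) ∧ distinct (toList v)) (∑ (Subsets (suc m)) (F (x ∷ v)))
                         ≡ ∑ bools (λ b → when (not (x ∈ᵇ toList v)) (H x v b))
    split-head x v = begin
      when (not (x ∈ᵇ toList v) ∧ distinct (toList v)) (∑ (Subsets (suc m)) (F (x ∷ v)))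
        ≡⟨ when-∧ (not (x ∈ᵇ toList v)) (distinct (toList v)) _ ⟩
      when (not (x ∈ᵇ toList v)) (when (distinct (toList v)) (∑ (Subsets (suc m)) (F (x ∷ v))))
        ≡⟨ cong (λ t → when (not (x ∈ᵇ toList v)) (when (distinct (toList v)) t)) (∑-vecsOver-suc bools m (F (x ∷ v))) ⟩
      when (not (x ∈ᵇ toList v)) (when (distinct (toList v)) (∑ bools (λ b → ∑ (Subsets m) (λ J → F (x ∷ v) (b ∷ J)))))
        ≡⟨ cong (when (not (x ∈ᵇ toList v))) (when-∑ (distinct (toList v)) bools (λ b → ∑ (Subsets m) (λ J → F (x ∷ v) (b ∷ J)))) ⟩
      when (not (x ∈ᵇ toList v)) (∑ bools (H x v))
        ≡⟨ when-∑ (not (x ∈ᵇ toList v)) bools (H x v) ⟩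
      ∑ bools (λ b → when (not (x ∈ᵇ toList v)) (H x v b)) ∎

  ∑Signed-cong-⊆ᵇ : (A : List ℕ) (m : ℕ) {F G : Vec ℕ m → Vec Bool m → R} →
    (∀ u J → (toList u ⊆ᵇ A) ≡ true → distinct (toList u) ≡ true → F u J ≡ G u J) → ∑Signed A m F ≡ ∑Signed A m G
  ∑Signed-cong-⊆ᵇ A m {F} {G} e = ∑-vecsOver-cong-⊆ᵇ A m (λ u u⊆A → on-distinct u u⊆A (distinct (toList u)) refl)
    where
    on-distinct : ∀ u → (toList u ⊆ᵇ A) ≡ true → ∀ b → distinct (toList u) ≡ b →
      when b (∑ (Subsets m) (F u)) ≡ when b (∑ (Subsets m) (G u))
    on-distinct u u⊆A true  d = ∑-cong (Subsets m) (λ J → e u J u⊆A d)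
    on-distinct u u⊆A false d = refl

  ∑Signed-∑< : (A : List ℕ) (m r : ℕ) (G : ℕ → Vec ℕ m → Vec Bool m → R) →
    ∑Signed A m (λ u J → ∑< r (λ a → G a u J)) ≡ ∑< r (λ a → ∑Signed A m (G a))
  ∑Signed-∑< A m r G = begin
    ∑Signed A m (λ u J → ∑< r (λ a → G a u J))
      ≡⟨ ∑-cong (vecsOver A m) (λ u → cong (when (distinct (toList u))) (∑-comm (Subsets m) (upTo r) _)) ⟩
    ∑ (vecsOver A m) (λ u → when (distinct (toList u)) (∑< r (λ a → ∑ (Subsets m) (G a u))))
      ≡⟨ ∑-cong (vecsOver A m) (λ u → when-∑ (distinct (toList u)) (upTo r) _) ⟩
    ∑ (vecsOver A m) (λ u → ∑< r (λ a → when (distinct (toList u)) (∑ (Subsets m) (G a u))))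
      ≡⟨ ∑-comm (vecsOver A m) (upTo r) _ ⟩
    ∑< r (λ a → ∑Signed A m (G a)) ∎

  ∑Signed-* : (A : List ℕ) (m : ℕ) (c : R) (F : Vec ℕ m → Vec Bool m → R) →
    ∑Signed A m (λ u J → c * F u J) ≡ c * ∑Signed A m F
  ∑Signed-* A m c F = begin
    ∑Signed A m (λ u J → c * F u J)
      ≡⟨ ∑-cong (vecsOver A m) (λ u → cong (when (distinct (toList u))) (sym (*-∑ c (Subsets m) (F u)))) ⟩
    ∑ (vecsOver A m) (λ u → when (distinct (toList u)) (c * ∑ (Subsets m) (F u)))
      ≡⟨ ∑-cong (vecsOver A m) (λ u → when-* (distinct (toList u)) c _) ⟩
    ∑ (vecsOver A m) (λ u → c * when (distinct (toList u)) (∑ (Subsets m) (F u)))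
      ≡⟨ sym (*-∑ c (vecsOver A m) _) ⟩
    c * ∑Signed A m F ∎

open FiniteSums +-*-isCommutativeSemiring

length-filterᵇ : {A : Set} (p : A → Bool) (xs : List A) → length (filterᵇ p xs) ≡ ∑ xs (λ x → when (p x) 1)
length-filterᵇ p []       = refl
length-filterᵇ p (x ∷ xs) with p x
... | true  = cong suc (length-filterᵇ p xs)
... | false = length-filterᵇ p xs

shift : ℕ → FPS → FPS
shift d f c = if d ≤ᵇ c then f (c ∸ d) else 0

monomial : ℕ → FPS
monomial d i = when (d ≡ᵇ i) 1

invPow : ℕ → FPS
invPow m = inv1-t ^ₛ suc m

sum-map : {A : Set} (f : A → ℕ) (xs : List A) → sum (map f xs) ≡ ∑ xs f
sum-map f []       = refl
sum-map f (x ∷ xs) = cong (f x +_) (sum-map f xs)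

⋆-∑< : (f g : FPS) (k : ℕ) → (f ⋆ g) k ≡ ∑< (suc k) (λ i → f i * g (k ∸ i))
⋆-∑< f g k = sum-map _ (upTo (suc k))

inv1-t-⋆ : (f : FPS) (c : ℕ) → (inv1-t ⋆ f) c ≡ ∑< (suc c) f
inv1-t-⋆ f zero    = +-identityʳ (f 0 + 0)
inv1-t-⋆ f (suc c) = begin
  (inv1-t ⋆ f) (suc c)                             ≡⟨ ⋆-∑< inv1-t f (suc c) ⟩
  ∑< (suc (suc c)) (λ i → 1 * f (suc c ∸ i))        ≡⟨ ∑<-suc (suc c) (λ i → 1 * f (suc c ∸ i)) ⟩
  1 * f (suc c) + ∑< (suc c) (λ i → 1 * f (c ∸ i))  ≡⟨ cong₂ _+_ (*-identityˡ (f (suc c))) (sym (⋆-∑< inv1-t f c)) ⟩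
  f (suc c) + (inv1-t ⋆ f) c                       ≡⟨ cong (f (suc c) +_) (inv1-t-⋆ f c) ⟩
  f (suc c) + ∑< (suc c) f                          ≡⟨ +-comm (f (suc c)) _ ⟩
  ∑< (suc c) f + f (suc c)                          ≡⟨ sym (∑<-∷ʳ (suc c) f) ⟩
  ∑< (suc (suc c)) f                                ∎

invPow-zero : ∀ c → invPow 0 c ≡ 1
invPow-zero c = begin
  (inv1-t ⋆ oneS) c        ≡⟨ inv1-t-⋆ oneS c ⟩
  ∑< (suc c) oneS          ≡⟨ ∑<-suc c oneS ⟩
  1 + ∑< c (λ _ → 0)       ≡⟨ cong suc (∑-zero (upTo c) (λ _ → refl)) ⟩
  1                        ∎

shift-suc : ∀ d f c → shift (suc d) f (suc c) ≡ shift d f c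
shift-suc zero    f c = refl
shift-suc (suc d) f c = refl

monomial-⋆ : ∀ d g k → (monomial d ⋆ g) k ≡ shift d g k
monomial-⋆ d g k = trans (⋆-∑< (monomial d) g k) (convolve d k)
  where
  convolve : ∀ d k → ∑< (suc k) (λ i → monomial d i * g (k ∸ i)) ≡ shift d g k
  convolve zero    k = begin
    ∑< (suc k) (λ i → monomial 0 i * g (k ∸ i))  ≡⟨ ∑<-suc k (λ i → monomial 0 i * g (k ∸ i)) ⟩
    1 * g k + ∑< k (λ _ → 0)                      ≡⟨ cong₂ _+_ (*-identityˡ (g k)) (∑-zero (upTo k) (λ _ → refl)) ⟩
    g k + 0                                       ≡⟨ +-identityʳ (g k) ⟩
    g k                                           ∎
  convolve (suc d) zero    = refl
  convolve (suc d) (suc k) = begin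
    ∑< (suc (suc k)) (λ i → monomial (suc d) i * g (suc k ∸ i)) ≡⟨ ∑<-suc (suc k) (λ i → monomial (suc d) i * g (suc k ∸ i)) ⟩
    ∑< (suc k) (λ i → monomial d i * g (k ∸ i))                 ≡⟨ convolve d k ⟩
    shift d g k                                                  ≡⟨ sym (shift-suc d g k) ⟩
    shift (suc d) g (suc k)                                      ∎

∑<-shift : ∀ d f c → ∑< (suc c) (shift d f) ≡ shift d (inv1-t ⋆ f) c
∑<-shift zero    f c       = sym (inv1-t-⋆ f c)
∑<-shift (suc d) f zero    = refl
∑<-shift (suc d) f (suc c) = begin
  ∑< (suc (suc c)) (shift (suc d) f)      ≡⟨ ∑<-suc (suc c) (shift (suc d) f) ⟩
  ∑< (suc c) (shift (suc d) f ∘ suc)      ≡⟨ ∑<-cong (suc c) (λ a _ → shift-suc d f a) ⟩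
  ∑< (suc c) (shift d f)                  ≡⟨ ∑<-shift d f c ⟩
  shift d (inv1-t ⋆ f) c                  ≡⟨ sym (shift-suc d (inv1-t ⋆ f) c) ⟩
  shift (suc d) (inv1-t ⋆ f) (suc c)      ∎

∑<-shift-strict : ∀ d f c → ∑< c (shift d f) ≡ shift (suc d) (inv1-t ⋆ f) c
∑<-shift-strict d f zero    = refl
∑<-shift-strict d f (suc c) = trans (∑<-shift d f c) (sym (shift-suc d (inv1-t ⋆ f) c))

generating-⋆ : {X : Set} (xs : List X) (q : X → Bool) (s : X → ℕ) (g : FPS) (k : ℕ) →
  ((λ j → length (filterᵇ (λ w → q w ∧ (s w ≡ᵇ j)) xs)) ⋆ g) k ≡ ∑ xs (λ w → when (q w) (shift (s w) g k))
generating-⋆ xs q s g k = begin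
  _ ≡⟨ ⋆-∑< (λ j → length (filterᵇ (λ w → q w ∧ (s w ≡ᵇ j)) xs)) g k ⟩
  ∑< (suc k) (λ i → length (filterᵇ (λ w → q w ∧ (s w ≡ᵇ i)) xs) * g (k ∸ i))
    ≡⟨ ∑<-cong (suc k) (λ i _ → trans (cong (_* g (k ∸ i)) (length-filterᵇ _ xs)) (∑-* xs _ _)) ⟩
  ∑< (suc k) (λ i → ∑ xs (λ w → when (q w ∧ (s w ≡ᵇ i)) 1 * g (k ∸ i)))
    ≡⟨ ∑-comm (upTo (suc k)) xs _ ⟩
  ∑ xs (λ w → ∑< (suc k) (λ i → when (q w ∧ (s w ≡ᵇ i)) 1 * g (k ∸ i)))
    ≡⟨ ∑-cong xs (λ w → ∑<-cong (suc k) (λ i _ → guard (q w) (s w ≡ᵇ i) (g (k ∸ i)))) ⟩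
  ∑ xs (λ w → ∑< (suc k) (λ i → when (q w) (monomial (s w) i * g (k ∸ i))))
    ≡⟨ ∑-cong xs (λ w → sym (when-∑ (q w) (upTo (suc k)) _)) ⟩
  ∑ xs (λ w → when (q w) (∑< (suc k) (λ i → monomial (s w) i * g (k ∸ i))))
    ≡⟨ ∑-cong xs (λ w → cong (when (q w)) (trans (sym (⋆-∑< (monomial (s w)) g k)) (monomial-⋆ (s w) g k))) ⟩
  ∑ xs (λ w → when (q w) (shift (s w) g k)) ∎
  where
  guard : ∀ a b r → when (a ∧ b) 1 * r ≡ when a (when b 1 * r)
  guard true  b r = refl
  guard false b r = refl

stepBound : ℤ → ℤ → ℕ → ℕ
stepBound x p c = if ⌊ x ℤ.<? p ⌋ then c else suc c

-- chains p c xs counts the sequences c ≥ a₁ ≥ ⋯ ≥ aₘ ≥ 0 (m = length xs) that drop strictly,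
-- aᵢ₋₁ > aᵢ, at every descent xᵢ₋₁ > xᵢ of p ∷ xs (where a₀ = c).
chains : ℤ → ℕ → List ℤ → ℕ
chains p c []       = 1
chains p c (x ∷ xs) = ∑< (stepBound x p c) (λ a → chains x a xs)

chains-descents : ∀ p c xs → chains p c xs ≡ shift (descentsList (p ∷ xs)) (invPow (length xs)) c
chains-descents p c []       = sym (invPow-zero c)
chains-descents p c (x ∷ xs) with ⌊ x ℤ.<? p ⌋
... | true  = trans (∑<-cong c (λ a _ → chains-descents x a xs))
                    (∑<-shift-strict (descentsList (x ∷ xs)) (invPow (length xs)) c)
... | false = trans (∑<-cong (suc c) (λ a _ → chains-descents x a xs))
                    (∑<-shift (descentsList (x ∷ xs)) (invPow (length xs)) c)

coeff-chains : (n : ℕ) (q : SignedPerm n → Bool) (k : ℕ) →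
  ((λ j → length (filterᵇ (λ w → q w ∧ (desB w ≡ᵇ j)) (Hyp n))) ⋆ invPow n) k
  ≡ ∑ (Hyp n) (λ w → when (q w) (chains (ℤ.+ 0) k (toList (window w))))
coeff-chains n q k = trans (generating-⋆ (Hyp n) q desB (invPow n) k)
  (∑-cong (Hyp n) (λ w → cong (when (q w)) (sym (trans
    (chains-descents (ℤ.+ 0) k (toList (window w)))
    (cong (λ m → shift (desB w) (invPow m) k) (length-toList (window w)))))))

+-<ᵇ : ∀ L a b → (L + a <ᵇ L + b) ≡ (a <ᵇ b)
+-<ᵇ zero    a b = refl
+-<ᵇ (suc L) a b = +-<ᵇ L a b

+-≤ᵇ : ∀ L a b → (L + a ≤ᵇ L + b) ≡ (a ≤ᵇ b)
+-≤ᵇ L a b = does-⇔ (mk⇔ (+-cancelˡ-≤ L a b) (+-monoʳ-≤ L)) (L + a ≤? L + b) (a ≤? b)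

module Keys (L : ℕ) where

  W : ℕ
  W = suc (L + L)

  -- ρ embeds the integers of absolute value at most L into [0, W), reversing their order.
  ρ : ℤ → ℕ
  ρ (ℤ.+ n)    = L ∸ n
  ρ ℤ.-[1+ n ] = L + suc n

  Bounded : ℤ → Set
  Bounded x = ℤ.∣ x ∣ ≤ L

  ρ<W : ∀ x → Bounded x → ρ x < W
  ρ<W (ℤ.+ n)    _   = s≤s (≤-trans (m∸n≤m L n) (m≤m+n L L))
  ρ<W ℤ.-[1+ n ] n<L = s≤s (+-monoʳ-≤ L n<L)

  <?-ρ : ∀ x p → Bounded p → ⌊ x ℤ.<? p ⌋ ≡ (ρ p <ᵇ ρ x)
  <?-ρ (ℤ.+ n)    (ℤ.+ m)    m≤L = trans (isYes≗does (ℤ.+ n ℤ.<? ℤ.+ m))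
    (does-⇔ (mk⇔ (λ n<m → ∸-monoʳ-< n<m m≤L)
                 (λ h → decidable-stable (n <? m) (λ n≮m → <⇒≱ h (∸-monoʳ-≤ L (≮⇒≥ n≮m)))))
            (n <? m) (L ∸ m <? L ∸ n))
  <?-ρ (ℤ.+ n)    ℤ.-[1+ m ] _ = sym (dec-false (L + suc m <? L ∸ n)
                                   (λ h → <⇒≱ (<-≤-trans h (m∸n≤m L n)) (m≤m+n L (suc m))))
  <?-ρ ℤ.-[1+ n ] (ℤ.+ m)    _ = sym (dec-true (L ∸ m <? L + suc n) (≤-<-trans (m∸n≤m L m) (m<m+n L z<s)))
  <?-ρ ℤ.-[1+ n ] ℤ.-[1+ m ] _ =
    trans (isYes≗does (ℤ.-[1+ n ] ℤ.<? ℤ.-[1+ m ])) (sym (+-<ᵇ L (suc m) (suc n)))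

  lex-≤ᵇ : ∀ a c r r′ → r < W → r′ < W → (a * W + r ≤ᵇ c * W + r′) ≡ (a <ᵇ (if r′ <ᵇ r then c else suc c))
  lex-≤ᵇ zero    zero    r r′ _   _ with r′ <ᵇ r in e
  ... | true  = dec-false (r ≤? r′) (<⇒≱ (<ᵇ⇒<′ r′ r e))
  ... | false = dec-true (r ≤? r′) (≮⇒≥ (does-false⇒¬ (r′ <? r) e))
  lex-≤ᵇ zero    (suc c) r r′ r<W _ =
    trans (dec-true (r ≤? (W + c * W) + r′) (≤-trans (<⇒≤ r<W) (≤-trans (m≤m+n W (c * W)) (m≤m+n _ r′))))
          (positive (r′ <ᵇ r))
    where positive : ∀ b → true ≡ (0 <ᵇ (if b then suc c else suc (suc c)))
          positive true  = refl
          positive false = refl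
  lex-≤ᵇ (suc a) zero    r r′ _ r′<W =
    trans (dec-false ((W + a * W) + r ≤? r′) (<⇒≱ (<-≤-trans r′<W (≤-trans (m≤m+n W (a * W)) (m≤m+n _ r)))))
          (too-big (r′ <ᵇ r))
    where too-big : ∀ b → false ≡ (suc a <ᵇ (if b then 0 else 1))
          too-big true  = refl
          too-big false = refl
  lex-≤ᵇ (suc a) (suc c) r r′ r<W r′<W = begin
    (W + a * W) + r ≤ᵇ (W + c * W) + r′      ≡⟨ cong₂ _≤ᵇ_ (+-assoc W (a * W) r) (+-assoc W (c * W) r′) ⟩
    W + (a * W + r) ≤ᵇ W + (c * W + r′)      ≡⟨ +-≤ᵇ W (a * W + r) (c * W + r′) ⟩
    a * W + r ≤ᵇ c * W + r′                  ≡⟨ lex-≤ᵇ a c r r′ r<W r′<W ⟩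
    a <ᵇ (if r′ <ᵇ r then c else suc c)      ≡⟨ shift-both (r′ <ᵇ r) ⟩
    suc a <ᵇ (if r′ <ᵇ r then suc c else suc (suc c)) ∎
    where shift-both : ∀ b → (a <ᵇ (if b then c else suc c)) ≡ (suc a <ᵇ (if b then suc c else suc (suc c)))
          shift-both true  = refl
          shift-both false = refl

  lex-cancel : ∀ a c r r′ → r < W → r′ < W → a * W + r ≡ c * W + r′ → r ≡ r′
  lex-cancel zero    zero    r r′ _   _   e = e
  lex-cancel zero    (suc c) r r′ r<W _   e =
    ⊥-elim (<⇒≱ r<W (subst (W ≤_) (sym e) (≤-trans (m≤m+n W (c * W)) (m≤m+n _ r′))))
  lex-cancel (suc a) zero    r r′ _   r′<W e =
    ⊥-elim (<⇒≱ r′<W (subst (W ≤_) e (≤-trans (m≤m+n W (a * W)) (m≤m+n _ r))))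
  lex-cancel (suc a) (suc c) r r′ r<W r′<W e = lex-cancel a c r r′ r<W r′<W
    (+-cancelˡ-≡ W _ _ (trans (sym (+-assoc W (a * W) r)) (trans e (+-assoc W (c * W) r′))))

  ρ-injective : ∀ x x′ → Bounded x → Bounded x′ → ρ x ≡ ρ x′ → x ≡ x′
  ρ-injective (ℤ.+ n)    (ℤ.+ n′)    n≤L n′≤L e = cong ℤ.+_ (∸-cancelˡ-≡ n≤L n′≤L e)
  ρ-injective (ℤ.+ n)    ℤ.-[1+ n′ ] _   _    e = ⊥-elim (<⇒≱ (m<m+n L z<s) (subst (_≤ L) e (m∸n≤m L n)))
  ρ-injective ℤ.-[1+ n ] (ℤ.+ n′)    _   _    e = ⊥-elim (<⇒≱ (m<m+n L z<s) (subst (_≤ L) (sym e) (m∸n≤m L n′)))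
  ρ-injective ℤ.-[1+ n ] ℤ.-[1+ n′ ] _   _    e = cong ℤ.-[1+_] (suc-injective (+-cancelˡ-≡ L _ _ e))

  -- κ a x codes the pair (a , x): codes compare first by a and then by x in reverse, which is
  -- the order in which the entries of a compatible sequence are sorted.
  κ : ℕ → ℤ → ℕ
  κ a x = a * W + ρ x

  κ-≤ᵇ : ∀ a c x p → Bounded x → Bounded p → (κ a x ≤ᵇ κ c p) ≡ (a <ᵇ stepBound x p c)
  κ-≤ᵇ a c x p bx bp = trans (lex-≤ᵇ a c (ρ x) (ρ p) (ρ<W x bx) (ρ<W p bp))
    (cong (λ b → a <ᵇ (if b then c else suc c)) (sym (<?-ρ x p bp)))

  κ-injective : ∀ a a′ x x′ → Bounded x → Bounded x′ → κ a x ≡ κ a′ x′ → x ≡ x′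
  κ-injective a a′ x x′ bx bx′ e = ρ-injective x x′ bx bx′ (lex-cancel a a′ (ρ x) (ρ x′) (ρ<W x bx) (ρ<W x′ bx′) e)

module LargestKey {I : Set} (idx : List I) (key : ℕ → I → ℕ) where

  keys≤ keys< keys≡ : ℕ → ℕ → ℕ
  keys≤ z β = ∑ idx (λ i → when (key z i ≤ᵇ β) 1)
  keys< z β = ∑ idx (λ i → when (key z i <ᵇ β) 1)
  keys≡ z β = ∑ idx (λ i → when (key z i ≡ᵇ β) 1)

  byLargest : (ℕ → ℕ → Bool) → List ℕ → ℕ → ℕ
  byLargest rel A β = ∑ A (λ x → ∑ idx (λ i → when (rel (key x i) β) (∏ (delete x A) (λ z → keys≤ z (key x i)))))

  <ᵇ-suc : ∀ k β → (k <ᵇ suc β) ≡ (k ≤ᵇ β)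
  <ᵇ-suc zero    β = refl
  <ᵇ-suc (suc k) β = refl

  when-≤ᵇ : ∀ k β t → when (k ≤ᵇ β) t ≡ when (k <ᵇ β) t + when (k ≡ᵇ β) t
  when-≤ᵇ zero    zero    t = refl
  when-≤ᵇ zero    (suc β) t = sym (+-identityʳ t)
  when-≤ᵇ (suc k) zero    t = refl
  when-≤ᵇ (suc k) (suc β) t = trans (cong (λ b → when b t) (<ᵇ-suc k β)) (when-≤ᵇ k β t)

  when-≡ᵇ : ∀ k β (g : ℕ → ℕ) → when (k ≡ᵇ β) (g k) ≡ when (k ≡ᵇ β) (g β)
  when-≡ᵇ k β g with k ≡ᵇ β in e
  ... | true rewrite ≡ᵇ⇒≡′ k β e = refl
  ... | false = refl

  keys≤-split : ∀ z β → keys≤ z β ≡ keys< z β + keys≡ z β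
  keys≤-split z β = trans (∑-cong idx (λ i → when-≤ᵇ (key z i) β 1)) (∑-+ idx _ _)

  byLargest-split : ∀ A β → byLargest _≤ᵇ_ A β ≡ byLargest _<ᵇ_ A β + byLargest _≡ᵇ_ A β
  byLargest-split A β = trans
    (∑-cong A (λ x → trans (∑-cong idx (λ i → when-≤ᵇ (key x i) β _)) (∑-+ idx _ _)))
    (∑-+ A _ _)

  byLargest-≡ᵇ : ∀ A β → byLargest _≡ᵇ_ A β ≡ ∑ A (λ x → keys≡ x β * ∏ (delete x A) (λ z → keys≤ z β))
  byLargest-≡ᵇ A β = ∑-cong A (λ x → begin
    ∑ idx (λ i → when (key x i ≡ᵇ β) (∏ (delete x A) (λ z → keys≤ z (key x i))))
      ≡⟨ ∑-cong idx (λ i → trans (when-≡ᵇ (key x i) β (λ t → ∏ (delete x A) (λ z → keys≤ z t)))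
                                 (sym (when-one (key x i ≡ᵇ β) _))) ⟩
    ∑ idx (λ i → when (key x i ≡ᵇ β) 1 * ∏ (delete x A) (λ z → keys≤ z β))
      ≡⟨ sym (∑-* idx _ _) ⟩
    keys≡ x β * ∏ (delete x A) (λ z → keys≤ z β) ∎)
    where
    when-one : ∀ b t → when b 1 * t ≡ when b t
    when-one true  t = +-identityʳ t
    when-one false t = refl

  keys≡-disjoint : ∀ x y β → (∀ i j → key x i ≡ key y j → x ≡ y) → (x ≡ᵇ y) ≡ false → keys≡ x β * keys≡ y β ≡ 0
  keys≡-disjoint x y β inj x≢y = trans (∑-* idx _ _) (∑-zero idx (λ i →
    trans (*-∑ (when (key x i ≡ᵇ β) 1) idx (λ j → when (key y j ≡ᵇ β) 1)) (∑-zero idx (λ j → clash i j))))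
    where
    clash : ∀ i j → when (key x i ≡ᵇ β) 1 * when (key y j ≡ᵇ β) 1 ≡ 0
    clash i j with key x i ≡ᵇ β in ex | key y j ≡ᵇ β in ey
    ... | true  | true  = ⊥-elim (true≢false (trans (sym (≡ᵇ-refl x))
                            (subst (λ t → (x ≡ᵇ t) ≡ false) (sym (inj i j (trans (≡ᵇ⇒≡′ _ β ex) (sym (≡ᵇ⇒≡′ _ β ey))))) x≢y)))
    ... | true  | false = refl
    ... | false | _     = refl

  module _ (a : ℕ) (A : List ℕ) (distinct-aA : distinct (a ∷ A) ≡ true)
           (separated : ∀ x y i j → (x ∈ᵇ (a ∷ A)) ≡ true → (y ∈ᵇ (a ∷ A)) ≡ true → key x i ≡ key y j → x ≡ y) where

    private B = a ∷ A

    mutual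
      -- A tuple of keys ≤ β consists of its largest entry, at some position x, and a tuple of keys
      -- ≤ that entry at the other positions; distinct positions never share a key.
      ∏-keys≤ : ∀ β → ∏ B (λ z → keys≤ z β) ≡ byLargest _≤ᵇ_ B β
      ∏-keys≤ β = begin
        ∏ B (λ z → keys≤ z β)
          ≡⟨ ∏-cong-∈ᵇ B (λ z _ → keys≤-split z β) ⟩
        ∏ B (λ z → keys< z β + keys≡ z β)
          ≡⟨ ∏-+-disjoint B (λ z → keys< z β) (λ z → keys≡ z β) distinct-aA
               (λ x y x∈B y∈B → keys≡-disjoint x y β (λ i j → separated x y i j x∈B y∈B)) ⟩
        ∏ B (λ z → keys< z β) + ∑ B (λ x → keys≡ x β * ∏ (delete x B) (λ z → keys< z β + keys≡ z β))
          ≡⟨ cong₂ _+_ (∏-keys< β) (∑-cong B (λ x → cong (keys≡ x β *_)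
                                      (sym (∏-cong-∈ᵇ (delete x B) (λ z _ → keys≤-split z β))))) ⟩
        byLargest _<ᵇ_ B β + ∑ B (λ x → keys≡ x β * ∏ (delete x B) (λ z → keys≤ z β))
          ≡⟨ cong (byLargest _<ᵇ_ B β +_) (sym (byLargest-≡ᵇ B β)) ⟩
        byLargest _<ᵇ_ B β + byLargest _≡ᵇ_ B β
          ≡⟨ sym (byLargest-split B β) ⟩
        byLargest _≤ᵇ_ B β ∎

      ∏-keys< : ∀ β → ∏ B (λ z → keys< z β) ≡ byLargest _<ᵇ_ B β
      ∏-keys< zero    = trans (cong (_* ∏ A (λ z → keys< z 0)) (∑-zero idx (λ _ → refl)))
                              (sym (∑-zero B (λ x → ∑-zero idx (λ _ → refl))))
      ∏-keys< (suc β) = begin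
        ∏ B (λ z → keys< z (suc β))  ≡⟨ ∏-cong-∈ᵇ B (λ z _ → ∑-cong idx (λ i → cong (λ t → when t 1) (<ᵇ-suc (key z i) β))) ⟩
        ∏ B (λ z → keys≤ z β)        ≡⟨ ∏-keys≤ β ⟩
        byLargest _≤ᵇ_ B β           ≡⟨ ∑-cong B (λ x → ∑-cong idx (λ i → cong (λ t → when t _) (sym (<ᵇ-suc (key x i) β)))) ⟩
        byLargest _<ᵇ_ B (suc β)     ∎

signed : Bool → ℕ → ℤ
signed b x = if b then ℤ.- (ℤ.+ x) else ℤ.+ x

∣signed∣ : ∀ b x → ℤ.∣ signed b x ∣ ≡ x
∣signed∣ true  x = ℤP.∣-i∣≡∣i∣ (ℤ.+ x)
∣signed∣ false x = refl

stepBound≤ : ∀ x p c → stepBound x p c ≤ suc c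
stepBound≤ x p c with ⌊ x ℤ.<? p ⌋
... | true  = n≤1+n c
... | false = ≤-refl

∑<-1 : ∀ r → ∑< r (λ _ → 1) ≡ r
∑<-1 r = trans (count (upTo r)) (length-upTo r)
  where count : (l : List ℕ) → ∑ l (λ _ → 1) ≡ length l
        count []      = refl
        count (x ∷ l) = cong suc (count l)

chainSum : List ℕ → (m : ℕ) → ℤ → ℕ → ℕ
chainSum A m p c = ∑Signed A m (λ u J → chains p c (toList (window (u , J))))

chainSum-∷ : ∀ A m p c → chainSum A (suc m) p c
  ≡ ∑ A (λ x → ∑ bools (λ b → ∑< (stepBound (signed b x) p c) (λ a → chainSum (delete x A) m (signed b x) a)))
chainSum-∷ A m p c = trans (∑Signed-∷ A m _) (∑-cong A (λ x → ∑-cong bools (λ b →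
  ∑Signed-∑< (delete x A) m (stepBound (signed b x) p c) (λ a u J → chains (signed b x) a (toList (window (u , J)))))))

module ChainCount (L Big : ℕ) where
  open Keys L public

  key : ℕ → Bool × ℕ → ℕ
  key z (b , a) = κ a (signed b z)

  open LargestKey (cartesianProduct bools (upTo Big)) key public

  bounded-signed : ∀ b x → x ≤ L → Bounded (signed b x)
  bounded-signed b x x≤L = subst (_≤ L) (sym (∣signed∣ b x)) x≤L

  separated : ∀ A → all (_≤ᵇ L) A ≡ true → ∀ x y i j → (x ∈ᵇ A) ≡ true → (y ∈ᵇ A) ≡ true → key x i ≡ key y j → x ≡ y
  separated A A≤L x y (b , a) (b′ , a′) x∈A y∈A e = begin
    x                          ≡⟨ sym (∣signed∣ b x) ⟩
    ℤ.∣ signed b x ∣            ≡⟨ cong ℤ.∣_∣ (κ-injective a a′ (signed b x) (signed b′ y)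
                                    (bounded-signed b x (≤ᵇ⇒≤′ x L (all-∈ᵇ _ x A A≤L x∈A)))
                                    (bounded-signed b′ y (≤ᵇ⇒≤′ y L (all-∈ᵇ _ y A A≤L y∈A))) e) ⟩
    ℤ.∣ signed b′ y ∣           ≡⟨ ∣signed∣ b′ y ⟩
    y                          ∎

  chainSum-∏ : ∀ m A p c → length A ≡ m → distinct A ≡ true → all (_≤ᵇ L) A ≡ true → Bounded p → c < Big →
    chainSum A m p c ≡ ∏ A (λ z → keys≤ z (κ c p))
  chainSum-∏ zero    []      p c _   _ _   _  _     = refl
  chainSum-∏ (suc m) (a ∷ A) p c len d A≤L bp c<Big = begin
    chainSum B (suc m) p c
      ≡⟨ chainSum-∷ B m p c ⟩
    ∑ B (λ x → ∑ bools (λ b → ∑< (stepBound (signed b x) p c) (λ a → chainSum (delete x B) m (signed b x) a)))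
      ≡⟨ ∑-cong-∈ᵇ B (λ x x∈B → trans (∑-cong bools (first-letter x x∈B))
                                       (sym (∑-cartesianProduct bools (upTo Big) _))) ⟩
    byLargest _≤ᵇ_ B (κ c p)
      ≡⟨ sym (∏-keys≤ a A d (separated B A≤L) (κ c p)) ⟩
    ∏ B (λ z → keys≤ z (κ c p)) ∎
    where
    B = a ∷ A
    first-letter : ∀ x → (x ∈ᵇ B) ≡ true → ∀ b →
      ∑< (stepBound (signed b x) p c) (λ a → chainSum (delete x B) m (signed b x) a)
      ≡ ∑< Big (λ a → when (κ a (signed b x) ≤ᵇ κ c p) (∏ (delete x B) (λ z → keys≤ z (κ a (signed b x)))))
    first-letter x x∈B b = begin
      ∑< r (λ a → chainSum (delete x B) m (signed b x) a)
        ≡⟨ ∑<-cong r (λ a a<r → chainSum-∏ m (delete x B) (signed b x) a len′ (distinct-delete x B d)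
                                   (all-delete _ x B A≤L) bx (≤-trans a<r r≤Big)) ⟩
      ∑< r Π                                              ≡⟨ ∑<-restrict Big r Π r≤Big ⟩
      ∑< Big (λ a → when (a <ᵇ r) (Π a))                  ≡⟨ ∑-cong (upTo Big) (λ a →
                                                               cong (λ t → when t (Π a)) (sym (κ-≤ᵇ a c (signed b x) p bx bp))) ⟩
      ∑< Big (λ a → when (κ a (signed b x) ≤ᵇ κ c p) (Π a)) ∎
      where
      r = stepBound (signed b x) p c
      Π : ℕ → ℕ
      Π a = ∏ (delete x B) (λ z → keys≤ z (κ a (signed b x)))
      r≤Big : r ≤ Big
      r≤Big = ≤-trans (stepBound≤ (signed b x) p c) c<Big
      bx : Bounded (signed b x)
      bx = bounded-signed b x (≤ᵇ⇒≤′ x L (all-∈ᵇ _ x B A≤L x∈B))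
      len′ : length (delete x B) ≡ m
      len′ = suc-injective (trans (length-delete x B d x∈B) len)

  keys≤-top : ∀ z k → suc z ≤ L → k < Big → keys≤ (suc z) (κ k (ℤ.+ 0)) ≡ 2 * k + 1
  keys≤-top z k z<L k<Big = begin
    keys≤ (suc z) (κ k (ℤ.+ 0))
      ≡⟨ ∑-cartesianProduct bools (upTo Big) _ ⟩
    ∑ bools (λ b → ∑< Big (λ a → when (κ a (signed b (suc z)) ≤ᵇ κ k (ℤ.+ 0)) 1))
      ≡⟨ ∑-cong bools count ⟩
    k + (suc k + 0)
      ≡⟨ solve 1 (λ k → k :+ ((con 1 :+ k) :+ con 0) := con 2 :* k :+ con 1) refl k ⟩
    2 * k + 1 ∎
    where
    open +-*-Solver
    count : ∀ b → ∑< Big (λ a → when (κ a (signed b (suc z)) ≤ᵇ κ k (ℤ.+ 0)) 1) ≡ stepBound (signed b (suc z)) (ℤ.+ 0) k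
    count b = begin
      ∑< Big (λ a → when (κ a (signed b (suc z)) ≤ᵇ κ k (ℤ.+ 0)) 1)
        ≡⟨ ∑-cong (upTo Big) (λ a → cong (λ t → when t 1) (κ-≤ᵇ a k (signed b (suc z)) (ℤ.+ 0) (bounded-signed b (suc z) z<L) z≤n)) ⟩
      ∑< Big (λ a → when (a <ᵇ r) 1)
        ≡⟨ sym (∑<-restrict Big r (λ _ → 1) (≤-trans (stepBound≤ (signed b (suc z)) (ℤ.+ 0) k) k<Big)) ⟩
      ∑< r (λ _ → 1)
        ≡⟨ ∑<-1 r ⟩
      r ∎
      where r = stepBound (signed b (suc z)) (ℤ.+ 0) k

∏-applyUpTo : (g f : ℕ → ℕ) (K n : ℕ) → (∀ i → i < n → f (g i) ≡ K) → ∏ (applyUpTo g n) f ≡ K ^ n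
∏-applyUpTo g f K zero    h = refl
∏-applyUpTo g f K (suc n) h = cong₂ _*_ (h 0 z<s) (∏-applyUpTo (g ∘ suc) f K n (λ i i<n → h (suc i) (s<s i<n)))

oneTo-distinct : ∀ n → distinct (oneTo n) ≡ true
oneTo-distinct n = distinct-applyUpTo suc n (λ i → ≤-refl)

∑-chains : ∀ n k → ∑ (Hyp n) (λ w → chains (ℤ.+ 0) k (toList (window w))) ≡ (2 * k + 1) ^ n
∑-chains n k = begin
  ∑ (Hyp n) (λ w → chains (ℤ.+ 0) k (toList (window w)))
    ≡⟨ ∑-Hyp n _ ⟩
  chainSum (oneTo n) n (ℤ.+ 0) k
    ≡⟨ chainSum-∏ n (oneTo n) (ℤ.+ 0) k (length-applyUpTo suc n) (oneTo-distinct n)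
         (all-applyUpTo (_≤ᵇ n) suc n (λ i i<n → dec-true (suc i ≤? n) i<n)) z≤n ≤-refl ⟩
  ∏ (oneTo n) (λ z → keys≤ z (κ k (ℤ.+ 0)))
    ≡⟨ ∏-applyUpTo suc _ (2 * k + 1) n (λ i i<n → keys≤-top i k i<n ≤-refl) ⟩
  (2 * k + 1) ^ n ∎
  where open ChainCount n (suc k)

module ℤΣ = FiniteSums ℤP.+-*-isCommutativeSemiring

ι : Bool → ℤ
ι b = ℤΣ.when b (ℤ.+ 1)

ι-∧ : ∀ a b → ι (a ∧ b) ≡ ι a ℤ.* ι b
ι-∧ true  b = sym (ℤP.*-identityˡ (ι b))
ι-∧ false b = refl

∏-ι : (q : ℕ → Bool) (A : List ℕ) → ℤΣ.∏ A (λ y → ι (q y)) ≡ ι (all q A)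
∏-ι q []      = refl
∏-ι q (a ∷ A) = trans (cong (ι (q a) ℤ.*_) (∏-ι q A)) (sym (ι-∧ (q a) (all q A)))

-- between y p = 1 iff -y < p ≤ y
between : ℕ → ℤ → ℤ
between y (ℤ.+ m)    = ι (m ≤ᵇ y)
between y ℤ.-[1+ m ] = ι (suc m <ᵇ y)

<ᵇ-⊓ : ∀ b x y → (b <ᵇ x ⊓ y) ≡ (b <ᵇ x) ∧ (b <ᵇ y)
<ᵇ-⊓ b x y = does-⇔ (mk⇔ (λ h → <-≤-trans h (m⊓n≤m x y) , <-≤-trans h (m⊓n≤n x y)) (λ (h , h′) → ⊓-glb h h′))
                    (b <? x ⊓ y) ((b <? x) ×-dec (b <? y))

≤ᵇ-⊓ : ∀ b x y → (b ≤ᵇ x ⊓ y) ≡ (b ≤ᵇ x) ∧ (b ≤ᵇ y)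
≤ᵇ-⊓ b x y = does-⇔ (mk⇔ (λ h → ≤-trans h (m⊓n≤m x y) , ≤-trans h (m⊓n≤n x y)) (λ (h , h′) → ⊓-glb h h′))
                    (b ≤? x ⊓ y) ((b ≤? x) ×-dec (b ≤? y))

between-⊓ : ∀ y y′ p → between y p ℤ.* between y′ p ≡ between (y ⊓ y′) p
between-⊓ y y′ (ℤ.+ m)    = trans (sym (ι-∧ (m ≤ᵇ y) (m ≤ᵇ y′))) (cong ι (sym (≤ᵇ-⊓ m y y′)))
between-⊓ y y′ ℤ.-[1+ m ] = trans (sym (ι-∧ (suc m <ᵇ y) (suc m <ᵇ y′))) (cong ι (sym (<ᵇ-⊓ (suc m) y y′)))

minimum⁺ : ℕ → List ℕ → ℕ
minimum⁺ a []      = a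
minimum⁺ a (b ∷ A) = a ⊓ minimum⁺ b A

∏-between : ∀ a A p → ℤΣ.∏ (a ∷ A) (λ y → between y p) ≡ between (minimum⁺ a A) p
∏-between a []      p = ℤP.*-identityʳ (between a p)
∏-between a (b ∷ A) p = trans (cong (between a p ℤ.*_) (∏-between b A p)) (between-⊓ a (minimum⁺ b A) p)

all<ᵇ-minimum⁺ : ∀ t a A → all (t <ᵇ_) (a ∷ A) ≡ (t <ᵇ minimum⁺ a A)
all<ᵇ-minimum⁺ t a []      = ∧-identityʳ (t <ᵇ a)
all<ᵇ-minimum⁺ t a (b ∷ A) = trans (cong ((t <ᵇ a) ∧_) (all<ᵇ-minimum⁺ t b A)) (sym (<ᵇ-⊓ t a (minimum⁺ b A)))

minimum⁺-∈ᵇ : ∀ a A → (minimum⁺ a A ∈ᵇ (a ∷ A)) ≡ true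
minimum⁺-∈ᵇ a []      = ∈ᵇ-head a []
minimum⁺-∈ᵇ a (b ∷ A) with ⊓-sel a (minimum⁺ b A)
... | inj₁ e rewrite e = ∈ᵇ-head a (b ∷ A)
... | inj₂ e rewrite e = ∈ᵇ-there (minimum⁺ b A) a (b ∷ A) (minimum⁺-∈ᵇ b A)

isMin : List ℕ → ℕ → ℤ
isMin A x = ι (all (x <ᵇ_) (delete x A))

∑-isMin : ∀ a A (f : ℕ → ℤ) → distinct (a ∷ A) ≡ true → ℤΣ.∑ (a ∷ A) (λ x → isMin (a ∷ A) x ℤ.* f x) ≡ f (minimum⁺ a A)
∑-isMin a []      f d rewrite ≡ᵇ-refl a = trans (ℤP.+-identityʳ _) (ℤP.*-identityˡ (f a))
∑-isMin a (b ∷ A) f d = begin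
  isMin B a ℤ.* f a ℤ.+ ℤΣ.∑ A′ (λ x → isMin B x ℤ.* f x)
    ≡⟨ cong₂ ℤ._+_ (cong (λ l → ι (all (a <ᵇ_) l) ℤ.* f a) (delete-head a A′ a∉A′)) (ℤΣ.∑-cong-∈ᵇ A′ later) ⟩
  ι (all (a <ᵇ_) A′) ℤ.* f a ℤ.+ ℤΣ.∑ A′ (λ x → isMin A′ x ℤ.* (ι (x <ᵇ a) ℤ.* f x))
    ≡⟨ cong₂ ℤ._+_ (cong (λ t → ι t ℤ.* f a) (all<ᵇ-minimum⁺ a b A)) (∑-isMin b A (λ x → ι (x <ᵇ a) ℤ.* f x) dA′) ⟩
  ι (a <ᵇ m) ℤ.* f a ℤ.+ ι (m <ᵇ a) ℤ.* f m
    ≡⟨ compare-heads ⟩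
  f (a ⊓ m) ∎
  where
  B = a ∷ b ∷ A
  A′ = b ∷ A
  m = minimum⁺ b A
  a∉A′ : (a ∈ᵇ A′) ≡ false
  a∉A′ = not-injective (proj₁ (∧-true {not (a ∈ᵇ A′)} d))
  dA′ : distinct A′ ≡ true
  dA′ = proj₂ (∧-true {not (a ∈ᵇ A′)} d)
  later : ∀ x → (x ∈ᵇ A′) ≡ true → isMin B x ℤ.* f x ≡ isMin A′ x ℤ.* (ι (x <ᵇ a) ℤ.* f x)
  later x x∈A′ = begin
    ι (all (x <ᵇ_) (delete x B)) ℤ.* f x
      ≡⟨ cong (λ l → ι (all (x <ᵇ_) l) ℤ.* f x) (delete-∷-≢ x a A′ (∈ᵇ-∉-≢ x a A′ x∈A′ a∉A′)) ⟩
    ι ((x <ᵇ a) ∧ all (x <ᵇ_) (delete x A′)) ℤ.* f x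
      ≡⟨ cong (ℤ._* f x) (trans (ι-∧ (x <ᵇ a) _) (ℤP.*-comm (ι (x <ᵇ a)) (isMin A′ x))) ⟩
    (isMin A′ x ℤ.* ι (x <ᵇ a)) ℤ.* f x
      ≡⟨ ℤP.*-assoc (isMin A′ x) (ι (x <ᵇ a)) (f x) ⟩
    isMin A′ x ℤ.* (ι (x <ᵇ a) ℤ.* f x) ∎
  compare-heads : ι (a <ᵇ m) ℤ.* f a ℤ.+ ι (m <ᵇ a) ℤ.* f m ≡ f (a ⊓ m)
  compare-heads with <-cmp a m
  ... | tri< a<m _ _ rewrite dec-true (a <? m) a<m | dec-false (m <? a) (<⇒≯ a<m) | m≤n⇒m⊓n≡m (<⇒≤ a<m)
      = trans (ℤP.+-identityʳ _) (ℤP.*-identityˡ (f a))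
  ... | tri≈ _ a≡m _ = ⊥-elim (true≢false (trans (sym (minimum⁺-∈ᵇ b A)) (subst (λ t → (t ∈ᵇ A′) ≡ false) a≡m a∉A′)))
  ... | tri> _ _ m<a rewrite dec-true (m <? a) m<a | dec-false (a <? m) (<⇒≯ m<a) | m≥n⇒m⊓n≡n (<⇒≤ m<a)
      = trans (ℤP.+-identityˡ _) (ℤP.*-identityˡ (f m))

negOnePow-+ : ∀ a b → negOnePow (a + b) ≡ negOnePow a ℤ.* negOnePow b
negOnePow-+ zero    b = sym (ℤP.*-identityˡ (negOnePow b))
negOnePow-+ (suc a) b = trans (cong ℤ.-_ (negOnePow-+ a b)) (ℤP.neg-distribˡ-* (negOnePow a) (negOnePow b))

σ : Bool → ℤ
σ true  = ℤ.-[1+ 0 ]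
σ false = ℤ.+ 1

smaller : ℕ → List ℕ → ℕ
smaller x l = length (filterᵇ (_<ᵇ x) l)

sgnB-∷ : ∀ {m} x (u : Vec ℕ m) b J → sgnB (x ∷ u , b ∷ J) ≡ σ b ℤ.* (negOnePow (smaller x (toList u)) ℤ.* sgnB (u , J))
sgnB-∷ x u b J = begin
  negOnePow (card (b ∷ J)) ℤ.* negOnePow (smaller x (toList u) + inversions (toList u))
    ≡⟨ cong₂ ℤ._*_ (card-∷ b) (negOnePow-+ (smaller x (toList u)) (inversions (toList u))) ⟩
  (σ b ℤ.* negOnePow (card J)) ℤ.* (negOnePow (smaller x (toList u)) ℤ.* negOnePow (inversions (toList u)))
    ≡⟨ solve 4 (λ s c l i → (s :* c) :* (l :* i) := s :* (l :* (c :* i))) refl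
         (σ b) (negOnePow (card J)) (negOnePow (smaller x (toList u))) (negOnePow (inversions (toList u))) ⟩
  σ b ℤ.* (negOnePow (smaller x (toList u)) ℤ.* sgnB (u , J)) ∎
  where
  open ℤSolver
  card-∷ : ∀ b → negOnePow (card (b ∷ J)) ≡ σ b ℤ.* negOnePow (card J)
  card-∷ true  = sym (ℤP.-1*i≡-i _)
  card-∷ false = sym (ℤP.*-identityˡ _)

+-∑ : {A : Set} (xs : List A) (f : A → ℕ) → ℤ.+ (∑ xs f) ≡ ℤΣ.∑ xs (λ x → ℤ.+ f x)
+-∑ []       f = refl
+-∑ (x ∷ xs) f = cong (ℤ._+_ (ℤ.+ f x)) (+-∑ xs f)

∑<-const : ∀ r K → ℤΣ.∑< r (λ _ → K) ≡ ℤ.+ r ℤ.* K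
∑<-const r K = trans (count (upTo r)) (cong (λ t → ℤ.+ t ℤ.* K) (length-upTo r))
  where
  count : (l : List ℕ) → ℤΣ.∑ l (λ _ → K) ≡ ℤ.+ length l ℤ.* K
  count []      = refl
  count (x ∷ l) = trans (cong (ℤ._+_ K) (count l))
    (solve 2 (λ K L → K :+ L :* K := (con (ℤ.+ 1) :+ L) :* K) refl K (ℤ.+ length l))
    where open ℤSolver

signedChainSum : List ℕ → (m : ℕ) → ℤ → ℕ → ℤ
signedChainSum A m p c = ℤΣ.∑Signed A m (λ u J → sgnB (u , J) ℤ.* ℤ.+ chains p c (toList (window (u , J))))

-- the sign picked up by moving x to the front of an arrangement of A
frontSign : List ℕ → ℕ → ℤ
frontSign A x = negOnePow (smaller x (delete x A))

signedChains-∷ : ∀ A x {m} (u : Vec ℕ m) b J p c → distinct A ≡ true → (x ∈ᵇ A) ≡ true → length A ≡ suc m →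
  (toList u ⊆ᵇ delete x A) ≡ true → distinct (toList u) ≡ true →
  sgnB (x ∷ u , b ∷ J) ℤ.* ℤ.+ chains p c (toList (window (x ∷ u , b ∷ J)))
  ≡ (σ b ℤ.* frontSign A x)
    ℤ.* ℤΣ.∑< (stepBound (signed b x) p c) (λ a → sgnB (u , J) ℤ.* ℤ.+ chains (signed b x) a (toList (window (u , J))))
signedChains-∷ A x {m} u b J p c dA x∈A lenA u⊆ du = begin
  sgnB (x ∷ u , b ∷ J) ℤ.* ℤ.+ ∑< r C
    ≡⟨ cong₂ ℤ._*_ (sgnB-∷ x u b J) (+-∑ (upTo r) C) ⟩
  (σ b ℤ.* (negOnePow (smaller x (toList u)) ℤ.* sgnB (u , J))) ℤ.* ℤΣ.∑< r (λ a → ℤ.+ C a)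
    ≡⟨ cong (λ t → (σ b ℤ.* (negOnePow t ℤ.* sgnB (u , J))) ℤ.* ℤΣ.∑< r (λ a → ℤ.+ C a))
            (length-filterᵇ-⊆ᵇ (_<ᵇ x) (toList u) (delete x A) du (distinct-delete x A dA) u⊆
                               (trans (length-toList u) (sym length-delete-x))) ⟩
  (σ b ℤ.* (frontSign A x ℤ.* sgnB (u , J))) ℤ.* ℤΣ.∑< r (λ a → ℤ.+ C a)
    ≡⟨ solve 4 (λ s n g t → (s :* (n :* g)) :* t := (s :* n) :* (g :* t)) refl
             (σ b) (frontSign A x) (sgnB (u , J)) (ℤΣ.∑< r (λ a → ℤ.+ C a)) ⟩
  (σ b ℤ.* frontSign A x) ℤ.* (sgnB (u , J) ℤ.* ℤΣ.∑< r (λ a → ℤ.+ C a))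
    ≡⟨ cong ((σ b ℤ.* frontSign A x) ℤ.*_) (ℤΣ.*-∑ (sgnB (u , J)) (upTo r) (λ a → ℤ.+ C a)) ⟩
  (σ b ℤ.* frontSign A x) ℤ.* ℤΣ.∑< r (λ a → sgnB (u , J) ℤ.* ℤ.+ C a) ∎
  where
  open ℤSolver
  r = stepBound (signed b x) p c
  C : ℕ → ℕ
  C a = chains (signed b x) a (toList (window (u , J)))
  length-delete-x : length (delete x A) ≡ m
  length-delete-x = suc-injective (trans (length-delete x A dA x∈A) lenA)

signedChainSum-∷ : ∀ A m p c → distinct A ≡ true → length A ≡ suc m →
  signedChainSum A (suc m) p c
  ≡ ℤΣ.∑ A (λ x → ℤΣ.∑ bools (λ b → (σ b ℤ.* frontSign A x)
                      ℤ.* ℤΣ.∑< (stepBound (signed b x) p c) (λ a → signedChainSum (delete x A) m (signed b x) a)))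
signedChainSum-∷ A m p c dA lenA =
  trans (ℤΣ.∑Signed-∷ A m _) (ℤΣ.∑-cong-∈ᵇ A (λ x x∈A → ℤΣ.∑-cong bools (λ b → begin
    ℤΣ.∑Signed (delete x A) m (λ u J → sgnB (x ∷ u , b ∷ J) ℤ.* ℤ.+ chains p c (toList (window (x ∷ u , b ∷ J))))
      ≡⟨ ℤΣ.∑Signed-cong-⊆ᵇ (delete x A) m (λ u J → signedChains-∷ A x u b J p c dA x∈A lenA) ⟩
    ℤΣ.∑Signed (delete x A) m (λ u J → s x b ℤ.* ℤΣ.∑< (r x b) (λ a → F x b a u J))
      ≡⟨ ℤΣ.∑Signed-* (delete x A) m (s x b) _ ⟩
    s x b ℤ.* ℤΣ.∑Signed (delete x A) m (λ u J → ℤΣ.∑< (r x b) (λ a → F x b a u J))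
      ≡⟨ cong (s x b ℤ.*_) (ℤΣ.∑Signed-∑< (delete x A) m (r x b) (F x b)) ⟩
    s x b ℤ.* ℤΣ.∑< (r x b) (λ a → signedChainSum (delete x A) m (signed b x) a) ∎)))
  where
  r : ℕ → Bool → ℕ
  r x b = stepBound (signed b x) p c
  s : ℕ → Bool → ℤ
  s x b = σ b ℤ.* frontSign A x
  F : ℕ → Bool → ℕ → Vec ℕ m → Vec Bool m → ℤ
  F x b a u J = sgnB (u , J) ℤ.* ℤ.+ chains (signed b x) a (toList (window (u , J)))

-- The two signs of a nonzero letter contribute bounds that differ exactly when -y < p ≤ y.
∑-signs-stepBound : ∀ y p c → ℤΣ.∑ bools (λ b → σ b ℤ.* ℤ.+ stepBound (signed b (suc y)) p c) ≡ between (suc y) p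
∑-signs-stepBound y (ℤ.+ m) c
  rewrite isYes≗does (ℤ.+ suc y ℤ.<? ℤ.+ m) with suc y <ᵇ m in e
... | true  rewrite dec-false (m ≤? suc y) (<⇒≱ (<ᵇ⇒<′ (suc y) m e)) =
  solve 1 (λ C → con ℤ.-[1+ 0 ] :* C :+ (con (ℤ.+ 1) :* C :+ con (ℤ.+ 0)) := con (ℤ.+ 0)) refl (ℤ.+ c)
  where open ℤSolver
... | false rewrite dec-true (m ≤? suc y) (≮⇒≥ (does-false⇒¬ (suc y <? m) e)) =
  solve 1 (λ C → con ℤ.-[1+ 0 ] :* C :+ (con (ℤ.+ 1) :* (con (ℤ.+ 1) :+ C) :+ con (ℤ.+ 0)) := con (ℤ.+ 1)) refl (ℤ.+ c)
  where open ℤSolver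
∑-signs-stepBound y ℤ.-[1+ m ] c
  rewrite isYes≗does (ℤ.-[1+ y ] ℤ.<? ℤ.-[1+ m ]) with m <ᵇ y
... | true  = solve 1 (λ C → con ℤ.-[1+ 0 ] :* C :+ (con (ℤ.+ 1) :* (con (ℤ.+ 1) :+ C) :+ con (ℤ.+ 0)) := con (ℤ.+ 1)) refl (ℤ.+ c)
  where open ℤSolver
... | false = solve 1 (λ C → con ℤ.-[1+ 0 ] :* (con (ℤ.+ 1) :+ C) :+ (con (ℤ.+ 1) :* (con (ℤ.+ 1) :+ C) :+ con (ℤ.+ 0)) := con (ℤ.+ 0)) refl (ℤ.+ c)
  where open ℤSolver

between-signed : ∀ b x y → (suc x ≡ᵇ y) ≡ false → between y (signed b (suc x)) ≡ ι (suc x <ᵇ y)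
between-signed true  x y _   = refl
between-signed false x y x≢y = cong ι (does-⇔
  (mk⇔ (λ x≤y → ≤∧≢⇒< x≤y (does-false⇒¬ (suc x ≟ y) x≢y)) <⇒≤) (suc x ≤? y) (suc x <? y))

smaller-all> : ∀ x l → all (x <ᵇ_) l ≡ true → smaller x l ≡ 0
smaller-all> x []      _ = refl
smaller-all> x (y ∷ l) h with ∧-true {x <ᵇ y} h
... | x<y , rest rewrite dec-false (y <? x) (<⇒≯ (<ᵇ⇒<′ x y x<y)) = smaller-all> x l rest

frontSign-isMin : ∀ A x → frontSign A x ℤ.* isMin A x ≡ isMin A x
frontSign-isMin A x with all (x <ᵇ_) (delete x A) in e
... | true rewrite smaller-all> x (delete x A) e = refl
... | false = ℤP.*-zeroʳ (frontSign A x)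

signedChainSum-∏ : ∀ m A p c → length A ≡ m → distinct A ≡ true → all (0 <ᵇ_) A ≡ true →
  signedChainSum A m p c ≡ ℤΣ.∏ A (λ y → between y p)
signedChainSum-∏ zero    []      p c _   _ _   = refl
signedChainSum-∏ (suc m) (a ∷ A) p c len d pos = begin
  signedChainSum B (suc m) p c
    ≡⟨ signedChainSum-∷ B m p c d len ⟩
  ℤΣ.∑ B (λ x → ℤΣ.∑ bools (λ b → (σ b ℤ.* frontSign B x)
                  ℤ.* ℤΣ.∑< (stepBound (signed b x) p c) (λ a → signedChainSum (delete x B) m (signed b x) a)))
    ≡⟨ ℤΣ.∑-cong-∈ᵇ B per-letter ⟩
  ℤΣ.∑ B (λ x → isMin B x ℤ.* between x p)
    ≡⟨ ∑-isMin a A (λ x → between x p) d ⟩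
  between (minimum⁺ a A) p
    ≡⟨ sym (∏-between a A p) ⟩
  ℤΣ.∏ B (λ y → between y p) ∎
  where
  B = a ∷ A
  per-letter : ∀ x → (x ∈ᵇ B) ≡ true →
    ℤΣ.∑ bools (λ b → (σ b ℤ.* frontSign B x)
                  ℤ.* ℤΣ.∑< (stepBound (signed b x) p c) (λ a → signedChainSum (delete x B) m (signed b x) a))
    ≡ isMin B x ℤ.* between x p
  per-letter zero    0∈B = ⊥-elim (true≢false (sym (all-∈ᵇ (0 <ᵇ_) 0 B pos 0∈B)))
  per-letter (suc y) x∈B = begin
    ℤΣ.∑ bools (λ b → (σ b ℤ.* ν) ℤ.* ℤΣ.∑< (r b) (λ a → signedChainSum (delete x B) m (signed b x) a))
      ≡⟨ ℤΣ.∑-cong bools (λ b → cong ((σ b ℤ.* ν) ℤ.*_)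
           (trans (ℤΣ.∑<-cong (r b) (λ a _ → sub-sum b a)) (∑<-const (r b) μ))) ⟩
    ℤΣ.∑ bools (λ b → (σ b ℤ.* ν) ℤ.* (ℤ.+ r b ℤ.* μ))
      ≡⟨ solve 6 (λ s₁ s₂ n r₁ r₂ k → (s₁ :* n) :* (r₁ :* k) :+ ((s₂ :* n) :* (r₂ :* k) :+ con (ℤ.+ 0))
                                       := (n :* k) :* (s₁ :* r₁ :+ (s₂ :* r₂ :+ con (ℤ.+ 0))))
               refl (σ true) (σ false) ν (ℤ.+ r true) (ℤ.+ r false) μ ⟩
    (ν ℤ.* μ) ℤ.* ℤΣ.∑ bools (λ b → σ b ℤ.* ℤ.+ r b)
      ≡⟨ cong₂ ℤ._*_ (frontSign-isMin B x) (∑-signs-stepBound y p c) ⟩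
    μ ℤ.* between x p ∎
    where
    open ℤSolver
    x = suc y
    r : Bool → ℕ
    r b = stepBound (signed b x) p c
    ν = frontSign B x
    μ = isMin B x
    -- by induction the inner sum no longer depends on a or b: it is 1 iff x is the minimum of B
    sub-sum : ∀ b a → signedChainSum (delete x B) m (signed b x) a ≡ μ
    sub-sum b a = begin
      signedChainSum (delete x B) m (signed b x) a
        ≡⟨ signedChainSum-∏ m (delete x B) (signed b x) a
             (suc-injective (trans (length-delete x B d x∈B) len)) (distinct-delete x B d) (all-delete (0 <ᵇ_) x B pos) ⟩
      ℤΣ.∏ (delete x B) (λ z → between z (signed b x))
        ≡⟨ ℤΣ.∏-cong-∈ᵇ (delete x B) (λ z z∈ → between-signed b y z (proj₂ (∈ᵇ-delete⁻ x z B z∈))) ⟩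
      ℤΣ.∏ (delete x B) (λ z → ι (x <ᵇ z))
        ≡⟨ ∏-ι (x <ᵇ_) (delete x B) ⟩
      μ ∎

∑-signed-chains : ∀ n k → ℤΣ.∑ (Hyp n) (λ w → sgnB w ℤ.* ℤ.+ chains (ℤ.+ 0) k (toList (window w))) ≡ ℤ.+ 1
∑-signed-chains n k = begin
  ℤΣ.∑ (Hyp n) (λ w → sgnB w ℤ.* ℤ.+ chains (ℤ.+ 0) k (toList (window w)))
    ≡⟨ ℤΣ.∑-Hyp n _ ⟩
  signedChainSum (oneTo n) n (ℤ.+ 0) k
    ≡⟨ signedChainSum-∏ n (oneTo n) (ℤ.+ 0) k (length-applyUpTo suc n) (oneTo-distinct n)
         (all-applyUpTo (0 <ᵇ_) suc n (λ _ _ → refl)) ⟩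
  ℤΣ.∏ (oneTo n) (λ y → between y (ℤ.+ 0))
    ≡⟨ ℤΣ.∏-1 (oneTo n) ⟩
  ℤ.+ 1 ∎

positive negative : ∀ {n} → SignedPerm n → Bool
positive w = ⌊ sgnB w ℤ.≟ ℤ.+ 1 ⌋
negative w = ⌊ sgnB w ℤ.≟ ℤ.- (ℤ.+ 1) ⌋

negOnePow-± : ∀ k → negOnePow k ≡ ℤ.+ 1 ⊎ negOnePow k ≡ ℤ.- (ℤ.+ 1)
negOnePow-± zero    = inj₁ refl
negOnePow-± (suc k) with negOnePow-± k
... | inj₁ e = inj₂ (cong ℤ.-_ e)
... | inj₂ e = inj₁ (cong ℤ.-_ e)

sgnB-± : ∀ {n} (w : SignedPerm n) → sgnB w ≡ ℤ.+ 1 ⊎ sgnB w ≡ ℤ.- (ℤ.+ 1)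
sgnB-± (u , J) with negOnePow-± (card J) | negOnePow-± (inversions (toList u))
... | inj₁ a | inj₁ b = inj₁ (cong₂ ℤ._*_ a b)
... | inj₁ a | inj₂ b = inj₂ (cong₂ ℤ._*_ a b)
... | inj₂ a | inj₁ b = inj₂ (cong₂ ℤ._*_ a b)
... | inj₂ a | inj₂ b = inj₁ (cong₂ ℤ._*_ a b)

split-by-sign : ∀ {n} (w : SignedPerm n) (c : ℕ) →
  when (positive w) c + when (negative w) c ≡ c
  × sgnB w ℤ.* ℤ.+ c ℤ.+ ℤ.+ when (negative w) c ≡ ℤ.+ when (positive w) c
split-by-sign w c with sgnB-± w
... | inj₁ e rewrite e = +-identityʳ c , trans (ℤP.+-identityʳ _) (ℤP.*-identityˡ (ℤ.+ c))
... | inj₂ e rewrite e = refl , trans (cong (ℤ._+ ℤ.+ c) (ℤP.-1*i≡-i (ℤ.+ c))) (ℤP.+-inverseˡ (ℤ.+ c))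

weightedBy : (n : ℕ) → (SignedPerm n → Bool) → ℕ → ℕ
weightedBy n q k = ∑ (Hyp n) (λ w → when (q w) (chains (ℤ.+ 0) k (toList (window w))))

positive+negative : ∀ n k → weightedBy n positive k + weightedBy n negative k ≡ (2 * k + 1) ^ n
positive+negative n k = begin
  weightedBy n positive k + weightedBy n negative k    ≡⟨ sym (∑-+ (Hyp n) _ _) ⟩
  ∑ (Hyp n) (λ w → when (positive w) (C w) + when (negative w) (C w))
                                                  ≡⟨ ∑-cong (Hyp n) (λ w → proj₁ (split-by-sign w (C w))) ⟩
  ∑ (Hyp n) C                                     ≡⟨ ∑-chains n k ⟩
  (2 * k + 1) ^ n ∎
  where
  C : SignedPerm n → ℕ
  C w = chains (ℤ.+ 0) k (toList (window w))

positive≡1+negative : ∀ n k → weightedBy n positive k ≡ suc (weightedBy n negative k)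
positive≡1+negative n k = ℤP.+-injective (sym (begin
  ℤ.+ 1 ℤ.+ ℤ.+ weightedBy n negative k
    ≡⟨ cong₂ ℤ._+_ (sym (∑-signed-chains n k)) (+-∑ (Hyp n) _) ⟩
  ℤΣ.∑ (Hyp n) (λ w → sgnB w ℤ.* ℤ.+ C w) ℤ.+ ℤΣ.∑ (Hyp n) (λ w → ℤ.+ when (negative w) (C w))
    ≡⟨ sym (ℤΣ.∑-+ (Hyp n) _ _) ⟩
  ℤΣ.∑ (Hyp n) (λ w → sgnB w ℤ.* ℤ.+ C w ℤ.+ ℤ.+ when (negative w) (C w))
    ≡⟨ ℤΣ.∑-cong (Hyp n) (λ w → proj₂ (split-by-sign w (C w))) ⟩
  ℤΣ.∑ (Hyp n) (λ w → ℤ.+ when (positive w) (C w))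
    ≡⟨ sym (+-∑ (Hyp n) _) ⟩
  ℤ.+ weightedBy n positive k ∎))
  where
  C : SignedPerm n → ℕ
  C w = chains (ℤ.+ 0) k (toList (window w))

halves-of-odd : ∀ X M → X ≡ suc (M + M) → (X + 1) / 2 ≡ suc M × (X ∸ 1) / 2 ≡ M
halves-of-odd X M refl =
  trans (cong (_/ 2) (solve 1 (λ M → (con 1 :+ (M :+ M)) :+ con 1 := (con 1 :+ M) :* con 2) refl M)) (m*n/n≡m (suc M) 2) ,
  trans (cong (_/ 2) (solve 1 (λ M → M :+ M := M :* con 2) refl M)) (m*n/n≡m M 2)
  where open +-*-Solver

-- The identity holds for n = 0 as well.
theorem5p2 : (n : ℕ) → 1 ≤ n → (k : ℕ) →
    ((BPlus n ⋆ (inv1-t ^ₛ (n + 1))) k ≡ ((2 * k + 1) ^ n + 1) / 2)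
    × ((BMinus n ⋆ (inv1-t ^ₛ (n + 1))) k ≡ ((2 * k + 1) ^ n ∸ 1) / 2)
theorem5p2 n _ k rewrite +-comm n 1 =
  trans (coeff-chains n positive k) (trans (positive≡1+negative n k) (sym upper)) ,
  trans (coeff-chains n negative k) (sym lower)
  where
  odd : (2 * k + 1) ^ n ≡ suc (weightedBy n negative k + weightedBy n negative k)
  odd = trans (sym (positive+negative n k)) (cong (_+ weightedBy n negative k) (positive≡1+negative n k))
  upper = proj₁ (halves-of-odd _ _ odd)
  lower = proj₂ (halves-of-odd _ _ odd)
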